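{- For every $r\ge1$, the Weil operator $\operatorname{O}^{(r)}_{\mathfrak{f}}(X_1,\dots,X_r)$ is a symmetric polynomial in $X_1,\dots,X_r$.
   Context: Let $\mathbb{F}_q$ be a finite field and $\mathfrak{f}(t)=a_nt^n+\cdots+a_0\in\mathbb{F}_q[t]$ monic of degree $n\ge1$. For a variable $X$, $\operatorname{D}_{\mathfrak{f}}$ is the $\mathbb{F}_q$-linear map on polynomials in $X$ of degree $<n$ with $\operatorname{D}_{\mathfrak{f}}(X^i)=\sum_{j=0}^{n-i-1}a_{i+j+1}X^j$. Weil operators: $\operatorname{O}^{(1)}_{\mathfrak{f}}=1$; $\operatorname{O}^{(2)}_{\mathfrak{f}}(X_1,X_2)=\sum_{k=0}^{n-1}\operatorname{D}_{\mathfrak{f}}(X_1^k)X_2^k$; for $r>2$, $\operatorname{O}^{(r)}_{\mathfrak{f}}(X_1,\dots,X_r)$ is the unique polynomial whose degree in each $X_i$ is $<n$ and which is congruent to $\prod_{j=1}^{r-1}\operatorname{O}^{(2)}_{\mathfrak{f}}(X_j,X_r)$ modulo $\mathfrak{f}(X_r)$. -}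

module Defs where

open import Level using (_⊔_)
open import Algebra.Bundles using (CommutativeRing)
open import Data.Nat as ℕ using (ℕ; zero; suc; _<_; _≤_; _∸_)
open import Data.Nat.Properties using (_<?_)
import Data.Nat.Properties as ℕP
open import Data.Fin as Fin using (Fin; fromℕ<; fromℕ; inject₁)
open import Data.Fin.Permutation using (Permutation′; _⟨$⟩ˡ_)
open import Data.List as List using (List; []; _∷_; _++_; map; concatMap; upTo; allFin; foldr)
open import Data.List.Relation.Unary.Any using (Any)
open import Data.Vec as Vec using (Vec; lookup; tabulate; zipWith; replicate)
open import Data.Vec.Properties using (≡-dec)
open import Data.Product using (Σ; ∃; _×_; _,_)
open import Data.Empty using (⊥)
open import Relation.Nullary using (¬_; yes; no; does)
open import Data.Bool using (if_then_else_)

record IsFiniteField {c ℓ} (R : CommutativeRing c ℓ) : Set (c ⊔ ℓ) where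
  open CommutativeRing R
  field
    0≉1      : ¬ (0# ≈ 1#)
    inverse  : ∀ x → ¬ (x ≈ 0#) → ∃ λ y → x * y ≈ 1#
    elements : List Carrier
    complete : ∀ x → Any (x ≈_) elements

module WeilDefs {c ℓ} (R : CommutativeRing c ℓ) where
  open CommutativeRing R

  -- Polynomials in r variables X_0,…,X_{r-1} over R: a finite formal sum of
  -- terms (coefficient , exponent vector).  Equality is coefficientwise.
  Poly : ℕ → Set c
  Poly r = List (Carrier × Vec ℕ r)

  coeff : ∀ {r} → Poly r → Vec ℕ r → Carrier
  coeff []             e = 0#
  coeff ((a , m) ∷ p)  e =
    (if does (≡-dec ℕP._≟_ m e) then a else 0#) + coeff p e

  infix 4 _≋_
  _≋_ : ∀ {r} → Poly r → Poly r → Set ℓ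
  P ≋ Q = ∀ e → coeff P e ≈ coeff Q e

  infixl 6 _+P_
  infixl 7 _*P_
  _+P_ : ∀ {r} → Poly r → Poly r → Poly r
  _+P_ = _++_

  _*P_ : ∀ {r} → Poly r → Poly r → Poly r
  P *P Q = concatMap (λ { (a , m) → map (λ { (b , m′) → (a * b , zipWith ℕ._+_ m m′) }) Q }) P

  oneP : ∀ {r} → Poly r
  oneP = (1# , replicate _ 0) ∷ []

  unit : ∀ {r} → Fin r → ℕ → Vec ℕ r
  unit i k = tabulate (λ l → if does (l Fin.≟ i) then k else 0)

  DegLt : ∀ {r} → ℕ → Poly r → Set ℓ
  DegLt n P = ∀ e i → n ≤ lookup e i → coeff P e ≈ 0#

  permute : ∀ {r} → Permutation′ r → Poly r → Poly r
  permute σ = map (λ { (a , m) → (a , tabulate (λ j → lookup m (σ ⟨$⟩ˡ j))) })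

  Symmetric : ∀ {r} → Poly r → Set ℓ
  Symmetric {r} P = ∀ (σ : Permutation′ r) → permute σ P ≋ P

  -- Monic f(t) = t^n + a_{n-1} t^{n-1} + … + a_0, given by n and a : Fin n → R.
  module _ (n : ℕ) (a : Fin n → Carrier) where

    A : ℕ → Carrier
    A k with k <? n
    ... | yes k<n = a (fromℕ< k<n)
    ... | no _ with k ℕP.≟ n
    ...   | yes _ = 1#
    ...   | no _  = 0#

    fAt : ∀ {r} → Fin r → Poly r
    fAt i = map (λ k → (A k , unit i k)) (upTo (suc n))

    -- O^(2)(X_i, X_j) = Σ_{k<n} D_f(X_i^k) X_j^k,
    -- D_f(X^k) = Σ_{l=0}^{n-k-1} a_{k+l+1} X^l
    O2 : ∀ {r} → Fin r → Fin r → Poly r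
    O2 i j = concatMap
      (λ k → map (λ l → (A (k ℕ.+ l ℕ.+ 1) , zipWith ℕ._+_ (unit i l) (unit j k)))
                 (upTo (n ∸ k)))
      (upTo n)

    -- P is the Weil operator O^(r)_f(X_1,…,X_r) (variables indexed 0…r-1).
    IsWeilOperator : (r : ℕ) → Poly r → Set (c ⊔ ℓ)
    IsWeilOperator zero P = Level.Lift (c ⊔ ℓ) ⊥
    IsWeilOperator (suc zero) P = Level.Lift c (P ≋ oneP)
    IsWeilOperator (suc (suc zero)) P = Level.Lift c (P ≋ O2 Fin.zero (Fin.suc Fin.zero))
    IsWeilOperator (suc (suc (suc m))) P =
      DegLt n P ×
      Σ (Poly (suc (suc (suc m)))) λ H →
        P ≋ foldr _*P_ oneP
                  (map (λ j → O2 (inject₁ j) (fromℕ (suc (suc m)))) (allFin (suc (suc m))))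
            +P fAt (fromℕ (suc (suc m))) *P H

{-# OPTIONS --safe #-}
module Submission where

open import Defs
open import Algebra.Bundles using (CommutativeRing)
open import Data.Nat using (ℕ; _≤_)
open import Data.Fin using (Fin)

open import Algebra.Bundles using (CommutativeMonoid)
open import Data.Bool using (true; false; if_then_else_)
open import Data.Nat as ℕ using (zero; suc; s≤s; z≤n; _∸_; _<_)
import Data.Nat.Properties as ℕ
open import Data.Fin as Fin using (zero; suc; fromℕ; inject₁; toℕ)
open import Data.Fin.Properties
  using (toℕ-fromℕ; toℕ-inject₁; fromℕ<-toℕ; toℕ<n; inject₁-injective; fromℕ≢inject₁; 0≢1+n; suc-injective;
         any?)
open import Data.Fin.Relation.Unary.Top using (View; view; ‵fromℕ; ‵inject₁)
open import Data.Fin.Permutation using (Permutation′; _⟨$⟩ˡ_; _⟨$⟩ʳ_; inverseˡ; inverseʳ)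
open import Data.List as List using (List; []; _∷_; _++_; map; concatMap; applyUpTo; upTo; foldr; allFin)
import Data.List.Properties as List
open import Data.List.Relation.Unary.All as All using (All; []; _∷_)
open import Data.List.Relation.Unary.All.Properties using (concat⁺; map⁺; applyUpTo⁺₁)
open import Data.Product using (_×_; _,_; proj₁; proj₂; ∃)
open import Data.Vec
  using (Vec; []; _∷_; lookup; tabulate; zipWith; replicate; _∷ʳ_; init; last; initLast; _[_]≔_)
open import Data.Vec.Properties
  using (≡-dec; ∷ʳ-injective; init-∷ʳ; last-∷ʳ; lookup-zipWith; lookup∘tabulate; lookup-replicate;
         lookup∘update; lookup∘update′)
open import Data.Vec.Relation.Binary.Pointwise.Extensional using (ext; Pointwise-≡⇒≡)
open import Data.Vec.Functional using (Vector)
open import Function using (_∘_; _⇔_; mk⇔; Equivalence)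
open import Function.Definitions using (Injective)
open import Level using (lower)
open import Relation.Binary.Bundles using (Setoid)
import Relation.Binary.Reasoning.Setoid
open import Relation.Binary.Definitions using (tri<; tri≈; tri>)
open import Relation.Binary.PropositionalEquality as ≡ using (_≡_; _≢_; cong; cong₂)
open import Relation.Nullary using (Dec; does; yes; no; contradiction)
open import Relation.Nullary.Decidable using (dec-true; dec-false; does-⇔)

-- Write r = k + 1 and view a polynomial in X_1, …, X_r as a polynomial in X_1, …, X_k whose
-- coefficients (its slices) are polynomials in X_r. The slice of ∏_{j≤k} O^(2)(X_j, X_r) at
-- X_1^{e_1} ⋯ X_k^{e_k} is ∏_{j≤k} D_f(X_r^{e_j}), so each slice of O^(r) is congruent to that product
-- modulo f(X_r). A slice p of O^(r) has degree < n, so its coefficient of t^{e_r} is τ(D_f(t^{e_r}) · p),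
-- where τ reads off the t^{n-1}-coordinate of the remainder modulo f: the D_f(t^j) form the basis dual
-- to the t^j under τ. Hence every coefficient of O^(r) whose exponents are all below n equals
-- τ(∏_{i≤r} D_f(t^{e_i})), which is symmetric in the exponents, and all other coefficients vanish.

module UnivariatePolynomial {c ℓ} (R : CommutativeRing c ℓ) where
  open CommutativeRing R hiding (zero)
  module ≈-Reasoning = Relation.Binary.Reasoning.Setoid setoid

  -- Dense coefficient lists, constant term first; _≐_ compares coefficients, so trailing zeros
  -- are invisible.
  UPoly : Set c
  UPoly = List Carrier

  coef : UPoly → ℕ → Carrier
  coef []      _       = 0#
  coef (a ∷ p) zero    = a
  coef (a ∷ p) (suc j) = coef p j

  infix 4 _≐_
  record _≐_ (p q : UPoly) : Set ℓ where
    constructor coefwise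
    field coef-≈ : ∀ j → coef p j ≈ coef q j
  open _≐_ public

  ≐-refl : ∀ {p} → p ≐ p
  ≐-refl = coefwise λ _ → refl

  ≐-sym : ∀ {p q} → p ≐ q → q ≐ p
  ≐-sym p≐q = coefwise λ j → sym (coef-≈ p≐q j)

  ≐-trans : ∀ {p q r} → p ≐ q → q ≐ r → p ≐ r
  ≐-trans p≐q q≐r = coefwise λ j → trans (coef-≈ p≐q j) (coef-≈ q≐r j)

  ≐-reflexive : ∀ {p q} → p ≡ q → p ≐ q
  ≐-reflexive ≡.refl = ≐-refl

  ≐-setoid : Setoid c ℓ
  ≐-setoid = record
    { Carrier = UPoly ; _≈_ = _≐_
    ; isEquivalence = record { refl = ≐-refl ; sym = ≐-sym ; trans = ≐-trans } }

  module ≐-Reasoning = Relation.Binary.Reasoning.Setoid ≐-setoid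

  ∷-cong : ∀ {a b p q} → a ≈ b → p ≐ q → a ∷ p ≐ b ∷ q
  ∷-cong a≈b p≐q = coefwise λ { zero → a≈b ; (suc j) → coef-≈ p≐q j }

  0∷[]≐[] : 0# ∷ [] ≐ []
  0∷[]≐[] = coefwise λ { zero → refl ; (suc j) → refl }

  infixr 7 _⋆_
  infixl 7 _⊛_
  infixl 6 _⊕_

  _⊕_ : UPoly → UPoly → UPoly
  []      ⊕ q       = q
  (a ∷ p) ⊕ []      = a ∷ p
  (a ∷ p) ⊕ (b ∷ q) = a + b ∷ p ⊕ q

  _⋆_ : Carrier → UPoly → UPoly
  a ⋆ []      = []
  a ⋆ (b ∷ p) = a * b ∷ a ⋆ p

  _⊛_ : UPoly → UPoly → UPoly
  []      ⊛ q = []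
  (a ∷ p) ⊛ q = a ⋆ q ⊕ (0# ∷ p ⊛ q)

  monomial : Carrier → ℕ → UPoly
  monomial a zero    = a ∷ []
  monomial a (suc s) = 0# ∷ monomial a s

  coef-⊕ : ∀ p q j → coef (p ⊕ q) j ≈ coef p j + coef q j
  coef-⊕ []      q       j       = sym (+-identityˡ _)
  coef-⊕ (a ∷ p) []      j       = sym (+-identityʳ _)
  coef-⊕ (a ∷ p) (b ∷ q) zero    = refl
  coef-⊕ (a ∷ p) (b ∷ q) (suc j) = coef-⊕ p q j

  coef-⋆ : ∀ a p j → coef (a ⋆ p) j ≈ a * coef p j
  coef-⋆ a []      j       = sym (zeroʳ a)
  coef-⋆ a (b ∷ p) zero    = refl
  coef-⋆ a (b ∷ p) (suc j) = coef-⋆ a p j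

  coef-monomial-≡ : ∀ a s → coef (monomial a s) s ≡ a
  coef-monomial-≡ a zero    = ≡.refl
  coef-monomial-≡ a (suc s) = coef-monomial-≡ a s

  coef-monomial-≢ : ∀ a {s j} → s ≢ j → coef (monomial a s) j ≡ 0#
  coef-monomial-≢ a {zero}  {zero}  s≢j = contradiction ≡.refl s≢j
  coef-monomial-≢ a {zero}  {suc j} s≢j = ≡.refl
  coef-monomial-≢ a {suc s} {zero}  s≢j = ≡.refl
  coef-monomial-≢ a {suc s} {suc j} s≢j = coef-monomial-≢ a (s≢j ∘ ≡.cong suc)

  ⊕-cong : ∀ {p p′ q q′} → p ≐ p′ → q ≐ q′ → p ⊕ q ≐ p′ ⊕ q′
  ⊕-cong {p} {p′} {q} {q′} p≐p′ q≐q′ = coefwise λ j → begin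
    coef (p ⊕ q) j          ≈⟨ coef-⊕ p q j ⟩
    coef p j + coef q j     ≈⟨ +-cong (coef-≈ p≐p′ j) (coef-≈ q≐q′ j) ⟩
    coef p′ j + coef q′ j   ≈⟨ coef-⊕ p′ q′ j ⟨
    coef (p′ ⊕ q′) j        ∎
    where open ≈-Reasoning

  ⊕-assoc : ∀ p q r → p ⊕ q ⊕ r ≐ p ⊕ (q ⊕ r)
  ⊕-assoc p q r = coefwise λ j → begin
    coef (p ⊕ q ⊕ r) j                ≈⟨ trans (coef-⊕ (p ⊕ q) r j) (+-congʳ (coef-⊕ p q j)) ⟩
    coef p j + coef q j + coef r j    ≈⟨ +-assoc _ _ _ ⟩
    coef p j + (coef q j + coef r j)  ≈⟨ trans (coef-⊕ p (q ⊕ r) j) (+-congˡ (coef-⊕ q r j)) ⟨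
    coef (p ⊕ (q ⊕ r)) j              ∎
    where open ≈-Reasoning

  ⊕-identityʳ : ∀ p → p ⊕ [] ≡ p
  ⊕-identityʳ []      = ≡.refl
  ⊕-identityʳ (a ∷ p) = ≡.refl

  0∷-⊕ : ∀ p q → (0# ∷ p) ⊕ (0# ∷ q) ≐ 0# ∷ p ⊕ q
  0∷-⊕ p q = ∷-cong (+-identityˡ 0#) ≐-refl

  ⋆-monomial : ∀ a b s → a ⋆ monomial b s ≐ monomial (a * b) s
  ⋆-monomial a b zero    = ≐-refl
  ⋆-monomial a b (suc s) = ∷-cong (zeroʳ a) (⋆-monomial a b s)

  0⋆ : ∀ p → 0# ⋆ p ≐ []
  0⋆ p = coefwise λ j → trans (coef-⋆ 0# p j) (zeroˡ _)

  monomial-⊛ : ∀ a b s t → monomial a s ⊛ monomial b t ≐ monomial (a * b) (s ℕ.+ t)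
  monomial-⊛ a b zero    t =
    ≐-trans (⊕-cong (⋆-monomial a b t) 0∷[]≐[]) (≐-reflexive (⊕-identityʳ _))
  monomial-⊛ a b (suc s) t =
    ≐-trans (⊕-cong (0⋆ (monomial b t)) ≐-refl) (∷-cong refl (monomial-⊛ a b s t))

  monomial-0# : ∀ s → monomial 0# s ≐ []
  monomial-0# zero    = 0∷[]≐[]
  monomial-0# (suc s) = ≐-trans (∷-cong refl (monomial-0# s)) 0∷[]≐[]

  ∑ : ∀ {x} {X : Set x} → List X → (X → UPoly) → UPoly
  ∑ []       F = []
  ∑ (x ∷ xs) F = F x ⊕ ∑ xs F

  syntax ∑ xs (λ x → p) = ∑[ x ← xs ] p

  module _ {x} {X : Set x} where

    ∑-cong : ∀ (xs : List X) {F G} → (∀ x → F x ≐ G x) → ∑ xs F ≐ ∑ xs G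
    ∑-cong []       F≐G = ≐-refl
    ∑-cong (x ∷ xs) F≐G = ⊕-cong (F≐G x) (∑-cong xs F≐G)

    ∑-++ : ∀ (xs ys : List X) F → ∑ (xs ++ ys) F ≐ ∑ xs F ⊕ ∑ ys F
    ∑-++ []       ys F = ≐-refl
    ∑-++ (x ∷ xs) ys F =
      ≐-trans (⊕-cong ≐-refl (∑-++ xs ys F)) (≐-sym (⊕-assoc (F x) (∑ xs F) (∑ ys F)))

    ∑-[] : ∀ (xs : List X) {F} → (∀ x → F x ≐ []) → ∑ xs F ≐ []
    ∑-[] []       F≐[] = ≐-refl
    ∑-[] (x ∷ xs) F≐[] = ⊕-cong (F≐[] x) (∑-[] xs F≐[])

    ∑-0∷ : ∀ (xs : List X) F → ∑[ x ← xs ] (0# ∷ F x) ≐ 0# ∷ ∑ xs F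
    ∑-0∷ []       F = ≐-sym 0∷[]≐[]
    ∑-0∷ (x ∷ xs) F = ≐-trans (⊕-cong ≐-refl (∑-0∷ xs F)) (0∷-⊕ (F x) (∑ xs F))

    ∑-map : ∀ {y} {Y : Set y} (g : Y → X) ys F → ∑ (map g ys) F ≡ ∑ ys (F ∘ g)
    ∑-map g []       F = ≡.refl
    ∑-map g (y ∷ ys) F = ≡.cong (F (g y) ⊕_) (∑-map g ys F)

    ∑-concatMap : ∀ {y} {Y : Set y} (g : Y → List X) ys F →
                  ∑ (concatMap g ys) F ≐ ∑[ y ← ys ] ∑ (g y) F
    ∑-concatMap g []       F = ≐-refl
    ∑-concatMap g (y ∷ ys) F =
      ≐-trans (∑-++ (g y) (concatMap g ys) F) (⊕-cong ≐-refl (∑-concatMap g ys F))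

  ∑-applyUpTo : ∀ (h : ℕ → ℕ) M F → ∑ (applyUpTo h M) F ≡ ∑ (upTo M) (F ∘ h)
  ∑-applyUpTo h zero    F = ≡.refl
  ∑-applyUpTo h (suc M) F =
    ≡.cong (F (h 0) ⊕_) (≡.trans (∑-applyUpTo (h ∘ suc) M F) (≡.sym (∑-applyUpTo suc M (F ∘ h))))

  ∑-δ : ∀ (Φ : ℕ → UPoly) x M →
        ∑[ l ← upTo M ] (if does (l ℕ.≟ x) then Φ l else []) ≐ (if does (x ℕ.<? M) then Φ x else [])
  -- The last two clauses go through because `suc l ℕ.≟ suc x` and `suc x ℕ.<? suc M` compute to
  -- `l ℕ.≟ x` and `x ℕ.<? M`.
  ∑-δ Φ x       zero    = ≐-refl
  ∑-δ Φ zero    (suc M) = begin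
    Φ 0 ⊕ ∑ (applyUpTo suc M) _  ≡⟨ ≡.cong (Φ 0 ⊕_) (∑-applyUpTo suc M _) ⟩
    Φ 0 ⊕ ∑ (upTo M) (λ _ → [])  ≈⟨ ⊕-cong ≐-refl (∑-[] (upTo M) (λ _ → ≐-refl)) ⟩
    Φ 0 ⊕ []                     ≡⟨ ⊕-identityʳ (Φ 0) ⟩
    Φ 0                          ∎
    where open ≐-Reasoning
  ∑-δ Φ (suc x) (suc M) = ≐-trans (≐-reflexive (∑-applyUpTo suc M _)) (∑-δ (Φ ∘ suc) x M)

  ∑-monomials : ∀ (g : ℕ → Carrier) M → ∑[ k ← upTo M ] monomial (g k) k ≐ applyUpTo g M
  ∑-monomials g zero    = ≐-refl
  ∑-monomials g (suc M) = begin
    (g 0 ∷ []) ⊕ ∑ (applyUpTo suc M) (λ k → monomial (g k) k)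
      ≡⟨ ≡.cong ((g 0 ∷ []) ⊕_) (∑-applyUpTo suc M _) ⟩
    (g 0 ∷ []) ⊕ ∑[ k ← upTo M ] (0# ∷ monomial (g (suc k)) k)
      ≈⟨ ⊕-cong ≐-refl (∑-0∷ (upTo M) _) ⟩
    (g 0 ∷ []) ⊕ (0# ∷ ∑[ k ← upTo M ] monomial (g (suc k)) k)
      ≈⟨ ∷-cong (+-identityʳ (g 0)) (∑-monomials (g ∘ suc) M) ⟩
    g 0 ∷ applyUpTo (g ∘ suc) M
      ∎
    where open ≐-Reasoning

  coef-applyUpTo-< : ∀ (g : ℕ → Carrier) {M k} → k ℕ.< M → coef (applyUpTo g M) k ≡ g k
  coef-applyUpTo-< g {suc M} {zero}  k<M = ≡.refl
  coef-applyUpTo-< g {suc M} {suc k} k<M = coef-applyUpTo-< (g ∘ suc) (ℕ.s<s⁻¹ k<M)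

  coef-applyUpTo-≥ : ∀ (g : ℕ → Carrier) {M k} → M ℕ.≤ k → coef (applyUpTo g M) k ≡ 0#
  coef-applyUpTo-≥ g {zero}          M≤k = ≡.refl
  coef-applyUpTo-≥ g {suc M} {suc k} M≤k = coef-applyUpTo-≥ (g ∘ suc) (ℕ.s≤s⁻¹ M≤k)

module ExponentVectors {c ℓ} (R : CommutativeRing c ℓ) where
  open import Data.Nat using (_+_)
  open ≡ using (refl)
  open ≡.≡-Reasoning
  open WeilDefs R using (unit)

  private variable k : ℕ

  lookup-ext : ∀ {u v : Vec ℕ k} → (∀ i → lookup u i ≡ lookup v i) → u ≡ v
  lookup-ext = Pointwise-≡⇒≡ ∘ ext

  init-∷ʳ-last : ∀ (m : Vec ℕ (suc k)) → m ≡ init m ∷ʳ last m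
  init-∷ʳ-last m = proj₂ (proj₂ (initLast m))

  ≡-∷ʳ⇔ : ∀ (m : Vec ℕ (suc k)) e′ j → m ≡ e′ ∷ʳ j ⇔ (init m ≡ e′ × last m ≡ j)
  ≡-∷ʳ⇔ m e′ j = mk⇔
    (λ m≡ → ∷ʳ-injective (init m) e′ (≡.trans (≡.sym (init-∷ʳ-last m)) m≡))
    (λ { (i≡ , l≡) → ≡.trans (init-∷ʳ-last m) (cong₂ _∷ʳ_ i≡ l≡) })

  lookup-∷ʳ-inject₁ : ∀ (u : Vec ℕ k) x i → lookup (u ∷ʳ x) (inject₁ i) ≡ lookup u i
  lookup-∷ʳ-inject₁ (y ∷ u) x Fin.zero    = refl
  lookup-∷ʳ-inject₁ (y ∷ u) x (Fin.suc i) = lookup-∷ʳ-inject₁ u x i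

  lookup-∷ʳ-fromℕ : ∀ (u : Vec ℕ k) x → lookup (u ∷ʳ x) (fromℕ k) ≡ x
  lookup-∷ʳ-fromℕ []      x = refl
  lookup-∷ʳ-fromℕ (y ∷ u) x = lookup-∷ʳ-fromℕ u x

  replicate-∷ʳ : ∀ k (x : ℕ) → replicate (suc k) x ≡ replicate k x ∷ʳ x
  replicate-∷ʳ zero    x = refl
  replicate-∷ʳ (suc k) x = cong (x ∷_) (replicate-∷ʳ k x)

  zipWith-∷ʳ : ∀ (f : ℕ → ℕ → ℕ) (u v : Vec ℕ k) x y →
               zipWith f (u ∷ʳ x) (v ∷ʳ y) ≡ zipWith f u v ∷ʳ f x y
  zipWith-∷ʳ f []      []      x y = refl
  zipWith-∷ʳ f (a ∷ u) (b ∷ v) x y = cong (f a b ∷_) (zipWith-∷ʳ f u v x y)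

  zipWith-init-∷ʳ-last : ∀ f (m m′ : Vec ℕ (suc k)) →
                         zipWith f m m′ ≡ zipWith f (init m) (init m′) ∷ʳ f (last m) (last m′)
  zipWith-init-∷ʳ-last f m m′ = begin
    zipWith f m m′
      ≡⟨ cong₂ (zipWith f) (init-∷ʳ-last m) (init-∷ʳ-last m′) ⟩
    zipWith f (init m ∷ʳ last m) (init m′ ∷ʳ last m′)
      ≡⟨ zipWith-∷ʳ f (init m) (init m′) (last m) (last m′) ⟩
    zipWith f (init m) (init m′) ∷ʳ f (last m) (last m′)
      ∎

  init-∷ʳ-+ : ∀ (u : Vec ℕ k) s m → init (zipWith _+_ (u ∷ʳ s) m) ≡ zipWith _+_ u (init m)
  init-∷ʳ-+ u s m = begin
    init (zipWith _+_ (u ∷ʳ s) m)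
      ≡⟨ cong init (zipWith-init-∷ʳ-last _+_ (u ∷ʳ s) m) ⟩
    init (zipWith _+_ (init (u ∷ʳ s)) (init m) ∷ʳ (last (u ∷ʳ s) + last m))
      ≡⟨ init-∷ʳ (last (u ∷ʳ s) + last m) (zipWith _+_ (init (u ∷ʳ s)) (init m)) ⟩
    zipWith _+_ (init (u ∷ʳ s)) (init m)
      ≡⟨ cong (λ w → zipWith _+_ w (init m)) (init-∷ʳ s u) ⟩
    zipWith _+_ u (init m)
      ∎

  last-∷ʳ-+ : ∀ (u : Vec ℕ k) s m → last (zipWith _+_ (u ∷ʳ s) m) ≡ s + last m
  last-∷ʳ-+ u s m = begin
    last (zipWith _+_ (u ∷ʳ s) m)
      ≡⟨ cong last (zipWith-init-∷ʳ-last _+_ (u ∷ʳ s) m) ⟩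
    last (zipWith _+_ (init (u ∷ʳ s)) (init m) ∷ʳ (last (u ∷ʳ s) + last m))
      ≡⟨ last-∷ʳ (last (u ∷ʳ s) + last m) (zipWith _+_ (init (u ∷ʳ s)) (init m)) ⟩
    last (u ∷ʳ s) + last m
      ≡⟨ cong (_+ last m) (last-∷ʳ s u) ⟩
    s + last m
      ∎

  +-replicate-0 : ∀ (m : Vec ℕ k) → zipWith _+_ m (replicate k 0) ≡ m
  +-replicate-0 m = lookup-ext λ i →
    ≡.trans (lookup-zipWith _+_ i m _) (≡.trans (cong (lookup m i +_) (lookup-replicate i 0)) (ℕ.+-identityʳ _))

  ∸-replicate-0 : ∀ (m : Vec ℕ k) → zipWith _∸_ m (replicate k 0) ≡ m
  ∸-replicate-0 m = lookup-ext λ i →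
    ≡.trans (lookup-zipWith _∸_ i m _) (cong (lookup m i ∸_) (lookup-replicate i 0))

  lookup-+ : ∀ {u v e : Vec ℕ k} → zipWith _+_ u v ≡ e → ∀ i → lookup u i + lookup v i ≡ lookup e i
  lookup-+ {u = u} {v} u+v≡e i = ≡.trans (≡.sym (lookup-zipWith _+_ i u v)) (cong (λ w → lookup w i) u+v≡e)

  +-≡⇔≡-∸ : ∀ {u e : Vec ℕ k} v → (∀ i → lookup u i ≤ lookup e i) →
            zipWith _+_ u v ≡ e ⇔ v ≡ zipWith _∸_ e u
  +-≡⇔≡-∸ {u = u} {e} v u≤e = mk⇔
    (λ u+v≡e → lookup-ext λ i → begin
      lookup v i                              ≡⟨ ℕ.m+n∸m≡n (lookup u i) (lookup v i) ⟨
      lookup u i + lookup v i ∸ lookup u i    ≡⟨ cong (_∸ lookup u i) (lookup-+ u+v≡e i) ⟩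
      lookup e i ∸ lookup u i                 ≡⟨ lookup-zipWith _∸_ i e u ⟨
      lookup (zipWith _∸_ e u) i              ∎)
    (λ { refl → lookup-ext λ i → begin
      lookup (zipWith _+_ u (zipWith _∸_ e u)) i   ≡⟨ lookup-zipWith _+_ i u _ ⟩
      lookup u i + lookup (zipWith _∸_ e u) i      ≡⟨ cong (lookup u i +_) (lookup-zipWith _∸_ i e u) ⟩
      lookup u i + (lookup e i ∸ lookup u i)       ≡⟨ ℕ.m+[n∸m]≡n (u≤e i) ⟩
      lookup e i                                   ∎ })

  +-≢ : ∀ {u e : Vec ℕ k} v i → lookup e i < lookup u i → zipWith _+_ u v ≢ e
  +-≢ {u = u} v i e<u u+v≡e =
    ℕ.<⇒≱ e<u (≡.subst (lookup u i ≤_) (lookup-+ u+v≡e i) (ℕ.m≤m+n (lookup u i) (lookup v i)))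

  init-∷ʳ-+-≡⇔ : ∀ {u e : Vec ℕ k} s m → (∀ i → lookup u i ≤ lookup e i) →
                 init (zipWith _+_ (u ∷ʳ s) m) ≡ e ⇔ init m ≡ zipWith _∸_ e u
  init-∷ʳ-+-≡⇔ {u = u} s m u≤e = mk⇔
    (Equivalence.to (+-≡⇔≡-∸ (init m) u≤e) ∘ ≡.trans (≡.sym (init-∷ʳ-+ u s m)))
    (≡.trans (init-∷ʳ-+ u s m) ∘ Equivalence.from (+-≡⇔≡-∸ (init m) u≤e))

  lookup-unit : ∀ (h : Fin k) l j → lookup (unit h l) j ≡ (if does (j Fin.≟ h) then l else 0)
  lookup-unit h l j = lookup∘tabulate _ j

  lookup-unit-≡ : ∀ (h : Fin k) l → lookup (unit h l) h ≡ l
  lookup-unit-≡ h l =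
    ≡.trans (lookup-unit h l h) (cong (λ b → if b then l else 0) (dec-true (h Fin.≟ h) refl))

  lookup-unit-≢ : ∀ {h j : Fin k} l → j ≢ h → lookup (unit h l) j ≡ 0
  lookup-unit-≢ {h = h} {j} l j≢h =
    ≡.trans (lookup-unit h l j) (cong (λ b → if b then l else 0) (dec-false (j Fin.≟ h) j≢h))

  lookup-unit-≤ : ∀ (h : Fin k) l j → lookup (unit h l) j ≤ l
  lookup-unit-≤ h l j with j Fin.≟ h
  ... | yes refl = ℕ.≤-reflexive (lookup-unit-≡ h l)
  ... | no  j≢h  = ≡.subst (_≤ l) (≡.sym (lookup-unit-≢ l j≢h)) ℕ.z≤n

  unit-injective : ∀ (h : Fin k) {l x} → unit h l ≡ unit h x → l ≡ x
  unit-injective h {l} {x} eq =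
    ≡.trans (≡.sym (lookup-unit-≡ h l)) (≡.trans (cong (λ u → lookup u h) eq) (lookup-unit-≡ h x))

  unit-≤ : ∀ (h : Fin k) {l} (e : Vec ℕ k) → l ≤ lookup e h → ∀ i → lookup (unit h l) i ≤ lookup e i
  unit-≤ h {l} e l≤e i with i Fin.≟ h
  ... | yes refl = ≡.subst (_≤ lookup e h) (≡.sym (lookup-unit-≡ h l)) l≤e
  ... | no  i≢h  = ≡.subst (_≤ lookup e i) (≡.sym (lookup-unit-≢ l i≢h)) ℕ.z≤n

  lookup-∸-unit : ∀ (e : Vec ℕ k) h l → lookup (zipWith _∸_ e (unit h l)) h ≡ lookup e h ∸ l
  lookup-∸-unit e h l = ≡.trans (lookup-zipWith _∸_ h e _) (cong (lookup e h ∸_) (lookup-unit-≡ h l))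

  ∸-unit-lookup : ∀ (e : Vec ℕ k) h → zipWith _∸_ e (unit h (lookup e h)) ≡ e [ h ]≔ 0
  ∸-unit-lookup e h = lookup-ext λ i → ≡.trans (lookup-zipWith _∸_ i e _) (pointwise i)
    where
    pointwise : ∀ i → lookup e i ∸ lookup (unit h (lookup e h)) i ≡ lookup (e [ h ]≔ 0) i
    pointwise i with i Fin.≟ h
    ... | yes refl = begin
      lookup e h ∸ lookup (unit h (lookup e h)) h  ≡⟨ cong (lookup e h ∸_) (lookup-unit-≡ h _) ⟩
      lookup e h ∸ lookup e h                      ≡⟨ ℕ.n∸n≡0 (lookup e h) ⟩
      0                                            ≡⟨ lookup∘update h e 0 ⟨
      lookup (e [ h ]≔ 0) h                        ∎
    ... | no  i≢h  = ≡.trans (cong (lookup e i ∸_) (lookup-unit-≢ _ i≢h)) (≡.sym (lookup∘update′ i≢h e 0))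

  unit-inject₁ : ∀ (h : Fin k) l → unit (inject₁ h) l ≡ unit h l ∷ʳ 0
  unit-inject₁ {k} h l = lookup-ext λ j → pointwise j (view j)
    where
    pointwise : ∀ j → View j → lookup (unit (inject₁ h) l) j ≡ lookup (unit h l ∷ʳ 0) j
    pointwise _ ‵fromℕ =
      ≡.trans (lookup-unit-≢ l (fromℕ≢inject₁ {i = h})) (≡.sym (lookup-∷ʳ-fromℕ (unit h l) 0))
    pointwise _ (‵inject₁ i) = begin
      lookup (unit (inject₁ h) l) (inject₁ i)
        ≡⟨ lookup-unit (inject₁ h) l (inject₁ i) ⟩
      (if does (inject₁ i Fin.≟ inject₁ h) then l else 0)
        ≡⟨ cong (λ b → if b then l else 0) (does-⇔ i≡h⇔ (inject₁ i Fin.≟ inject₁ h) (i Fin.≟ h)) ⟩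
      (if does (i Fin.≟ h) then l else 0)
        ≡⟨ lookup-unit h l i ⟨
      lookup (unit h l) i
        ≡⟨ lookup-∷ʳ-inject₁ (unit h l) 0 i ⟨
      lookup (unit h l ∷ʳ 0) (inject₁ i)
        ∎
      where i≡h⇔ = mk⇔ inject₁-injective (cong inject₁)

  unit-fromℕ : ∀ k s → unit (fromℕ k) s ≡ replicate k 0 ∷ʳ s
  unit-fromℕ k s = lookup-ext λ j → pointwise j (view j)
    where
    pointwise : ∀ j → View j → lookup (unit (fromℕ k) s) j ≡ lookup (replicate k 0 ∷ʳ s) j
    pointwise _ ‵fromℕ =
      ≡.trans (lookup-unit-≡ (fromℕ k) s) (≡.sym (lookup-∷ʳ-fromℕ (replicate k 0) s))
    pointwise _ (‵inject₁ i) = ≡.trans (lookup-unit-≢ s (fromℕ≢inject₁ {i = i} ∘ ≡.sym))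
      (≡.sym (≡.trans (lookup-∷ʳ-inject₁ (replicate k 0) s i) (lookup-replicate i 0)))

  unit-inject₁+unit-fromℕ : ∀ (h : Fin k) l s →
                            zipWith _+_ (unit (inject₁ h) l) (unit (fromℕ k) s) ≡ unit h l ∷ʳ s
  unit-inject₁+unit-fromℕ {k} h l s = begin
    zipWith _+_ (unit (inject₁ h) l) (unit (fromℕ k) s)  ≡⟨ cong₂ (zipWith _+_) (unit-inject₁ h l) (unit-fromℕ k s) ⟩
    zipWith _+_ (unit h l ∷ʳ 0) (replicate k 0 ∷ʳ s)     ≡⟨ zipWith-∷ʳ _+_ (unit h l) (replicate k 0) 0 s ⟩
    zipWith _+_ (unit h l) (replicate k 0) ∷ʳ s          ≡⟨ cong (_∷ʳ s) (+-replicate-0 (unit h l)) ⟩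
    unit h l ∷ʳ s                                        ∎

  permute-≡⇔ : ∀ (σ : Permutation′ k) (m e : Vec ℕ k) →
               tabulate (λ j → lookup m (σ ⟨$⟩ˡ j)) ≡ e ⇔ m ≡ tabulate (λ j → lookup e (σ ⟨$⟩ʳ j))
  permute-≡⇔ σ m e = mk⇔
    (λ { refl → lookup-ext λ i → ≡.sym (≡.trans (lookup∘tabulate _ i)
                   (≡.trans (lookup∘tabulate _ (σ ⟨$⟩ʳ i)) (cong (lookup m) (inverseˡ σ)))) })
    (λ { refl → lookup-ext λ i → ≡.trans (lookup∘tabulate _ i)
                   (≡.trans (lookup∘tabulate _ (σ ⟨$⟩ˡ i)) (cong (lookup e) (inverseʳ σ))) })

module Slices {c ℓ} (R : CommutativeRing c ℓ) where
  open CommutativeRing R hiding (zero)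
  open UnivariatePolynomial R
  open ExponentVectors R
  open WeilDefs R using (Poly; coeff; _*P_; _+P_; oneP; permute; DegLt) renaming (_≋_ to _≋ₚ_)

  private variable k : ℕ

  infix 4 _≟ᵥ_
  _≟ᵥ_ : (u v : Vec ℕ k) → Dec (u ≡ v)
  _≟ᵥ_ = ≡-dec ℕ._≟_

  Term : ℕ → Set c
  Term r = Carrier × Vec ℕ r

  infixl 7 _⊗_
  _⊗_ : Term k → Term k → Term k
  (a , m) ⊗ (b , m′) = (a * b , zipWith ℕ._+_ m m′)

  -- slice P e′ is the coefficient of X_1^{e′_1} ⋯ X_k^{e′_k} in P, a polynomial in X_{k+1}.
  termSlice : Vec ℕ k → Term (suc k) → UPoly
  termSlice e′ (b , m) = if does (init m ≟ᵥ e′) then monomial b (last m) else []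

  slice : Poly (suc k) → Vec ℕ k → UPoly
  slice P e′ = ∑[ t ← P ] termSlice e′ t

  coeff-∷ʳ : ∀ (P : Poly (suc k)) e′ j → coeff P (e′ ∷ʳ j) ≈ coef (slice P e′) j
  coeff-∷ʳ []            e′ j = refl
  coeff-∷ʳ ((b , m) ∷ P) e′ j = begin
    (if does (m ≟ᵥ e′ ∷ʳ j) then b else 0#) + coeff P (e′ ∷ʳ j)
      ≈⟨ +-cong (term (m ≟ᵥ e′ ∷ʳ j) (init m ≟ᵥ e′)) (coeff-∷ʳ P e′ j) ⟩
    coef (termSlice e′ (b , m)) j + coef (slice P e′) j
      ≈⟨ coef-⊕ (termSlice e′ (b , m)) (slice P e′) j ⟨
    coef (slice ((b , m) ∷ P) e′) j
      ∎
    where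
    open ≈-Reasoning
    open Equivalence (≡-∷ʳ⇔ m e′ j)
    term : (m≟ : Dec (m ≡ e′ ∷ʳ j)) (init≟ : Dec (init m ≡ e′)) →
           (if does m≟ then b else 0#) ≈ coef (if does init≟ then monomial b (last m) else []) j
    term (yes m≡) (yes _)     =
      reflexive (≡.sym (≡.trans (cong (λ s → coef (monomial b s) j) (proj₂ (to m≡))) (coef-monomial-≡ b j)))
    term (yes m≡) (no  init≢) = contradiction (proj₁ (to m≡)) init≢
    term (no  m≢) (yes init≡) = reflexive (≡.sym (coef-monomial-≢ b λ last≡ → m≢ (from (init≡ , last≡))))
    term (no  _)  (no  _)     = refl

  slice-cong : ∀ (P Q : Poly (suc k)) → P ≋ₚ Q → ∀ e′ → slice P e′ ≐ slice Q e′
  slice-cong P Q P≋Q e′ = coefwise λ j →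
    trans (sym (coeff-∷ʳ P e′ j)) (trans (P≋Q (e′ ∷ʳ j)) (coeff-∷ʳ Q e′ j))

  slice-+P : ∀ (P Q : Poly (suc k)) e′ → slice (P +P Q) e′ ≐ slice P e′ ⊕ slice Q e′
  slice-+P P Q e′ = ∑-++ P Q (termSlice e′)

  slice-*P : ∀ (P Q : Poly (suc k)) e′ → slice (P *P Q) e′ ≐ ∑[ t ← P ] ∑[ s ← Q ] termSlice e′ (t ⊗ s)
  slice-*P []            Q e′ = ≐-refl
  slice-*P ((a , m) ∷ P) Q e′ =
    ≐-trans (∑-++ (map (λ s → (a , m) ⊗ s) Q) (P *P Q) (termSlice e′))
            (⊕-cong (≐-reflexive (∑-map _ Q (termSlice e′))) (slice-*P P Q e′))

  termSlice-∷ʳ : ∀ (e′ u : Vec ℕ k) b s →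
                 termSlice e′ (b , u ∷ʳ s) ≡ (if does (u ≟ᵥ e′) then monomial b s else [])
  termSlice-∷ʳ e′ u b s = cong₂ (λ β t → if β then monomial b t else [])
    (does-⇔ (mk⇔ (≡.trans (≡.sym (init-∷ʳ s u))) (≡.trans (init-∷ʳ s u))) (init (u ∷ʳ s) ≟ᵥ e′) (u ≟ᵥ e′))
    (last-∷ʳ s u)

  termSlice-∷ʳ-≡ : ∀ (u : Vec ℕ k) b s → termSlice u (b , u ∷ʳ s) ≡ monomial b s
  termSlice-∷ʳ-≡ u b s = ≡.trans (termSlice-∷ʳ u u b s)
    (cong (λ β → if β then monomial b s else []) (dec-true (u ≟ᵥ u) ≡.refl))

  termSlice-∷ʳ-≢ : ∀ {e′ u : Vec ℕ k} b s → u ≢ e′ → termSlice e′ (b , u ∷ʳ s) ≡ []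
  termSlice-∷ʳ-≢ {e′ = e′} {u} b s u≢e′ = ≡.trans (termSlice-∷ʳ e′ u b s)
    (cong (λ β → if β then monomial b s else []) (dec-false (u ≟ᵥ e′) u≢e′))

  if-does-≈ : ∀ {A B : Set} (A? : Dec A) (B? : Dec B) → A ⇔ B → ∀ {x y} → x ≈ y →
              (if does A? then x else 0#) ≈ (if does B? then y else 0#)
  if-does-≈ A? B? A⇔B {x} {y} x≈y with does A? | does B? | does-⇔ A⇔B A? B?
  ... | true  | .true  | ≡.refl = x≈y
  ... | false | .false | ≡.refl = refl

  coeff-permute : ∀ (σ : Permutation′ k) P e →
                  coeff (permute σ P) e ≈ coeff P (tabulate (λ j → lookup e (σ ⟨$⟩ʳ j)))
  coeff-permute σ []            e = refl
  coeff-permute σ ((b , m) ∷ P) e =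
    +-cong (if-does-≈ (_ ≟ᵥ e) (m ≟ᵥ _) (permute-≡⇔ σ m e) refl) (coeff-permute σ P e)

  *P-oneP : ∀ {r} (P : Poly r) → P *P oneP ≋ₚ P
  *P-oneP []            e = refl
  *P-oneP ((b , m) ∷ P) e = +-cong (if-does-≈ (_ ≟ᵥ e) (m ≟ᵥ e) m+0≡e⇔m≡e (*-identityʳ b)) (*P-oneP P e)
    where
    m+0≡e⇔m≡e = mk⇔ (≡.trans (≡.sym (+-replicate-0 m))) (≡.trans (+-replicate-0 m))

  DegLt-cong : ∀ {r n} (P Q : Poly r) → P ≋ₚ Q → DegLt n Q → DegLt n P
  DegLt-cong P Q P≋Q Q<n e i n≤eᵢ = trans (P≋Q e) (Q<n e i n≤eᵢ)

  DegLt-from-terms : ∀ {r n} (P : Poly r) → All (λ t → ∀ i → lookup (proj₂ t) i ℕ.< n) P → DegLt n P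
  DegLt-from-terms []            []              e i n≤eᵢ = refl
  DegLt-from-terms ((b , m) ∷ P) (m<n ∷ terms<n) e i n≤eᵢ = begin
    (if does (m ≟ᵥ e) then b else 0#) + coeff P e
      ≡⟨ cong (λ β → (if β then b else 0#) + coeff P e) (dec-false (m ≟ᵥ e) m≢e) ⟩
    0# + coeff P e
      ≈⟨ +-identityˡ _ ⟩
    coeff P e
      ≈⟨ DegLt-from-terms P terms<n e i n≤eᵢ ⟩
    0#
      ∎
    where
    open ≈-Reasoning
    m≢e : m ≢ e
    m≢e m≡e = ℕ.<⇒≱ (m<n i) (≡.subst (λ v → _ ℕ.≤ lookup v i) (≡.sym m≡e) n≤eᵢ)

module CompanionOperator {c ℓ} (R : CommutativeRing c ℓ) (n′ : ℕ)
                         (a : Fin (suc n′) → CommutativeRing.Carrier R) where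
  open CommutativeRing R hiding (zero)
  open UnivariatePolynomial R
  open import Data.Vec.Functional.Relation.Binary.Equality.Setoid setoid public
    using (_≋_; ≋-refl; ≋-sym; ≋-trans; ≋-setoid)
  open import Algebra.Solver.Ring.NaturalCoefficients.Default commutativeSemiring
  open import Algebra.Properties.CommutativeSemigroup +-commutativeSemigroup
    using () renaming (interchange to +-interchange)

  N : ℕ
  N = suc n′

  V : Set c
  V = Vector Carrier N

  top : Fin N
  top = fromℕ n′

  infixl 6 _+ᵛ_
  infixr 7 _*ᵛ_

  _+ᵛ_ : V → V → V
  (u +ᵛ v) i = u i + v i

  _*ᵛ_ : Carrier → V → V
  (x *ᵛ v) i = x * v i

  0ᵛ : V
  0ᵛ _ = 0#

  e₀ : V
  e₀ zero    = 1#
  e₀ (suc _) = 0#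

  -- Multiplication by t on R[t]/(f), f = t^N + a_{N-1} t^{N-1} + … + a_0, in the basis
  -- 1, t, …, t^{N-1}: the companion matrix of f.
  mulX : V → V
  mulX v zero    = v top * - a zero
  mulX v (suc i) = v (inject₁ i) + v top * - a (suc i)

  mulX-cong : ∀ {u v} → u ≋ v → mulX u ≋ mulX v
  mulX-cong u≋v zero    = *-congʳ (u≋v top)
  mulX-cong u≋v (suc i) = +-cong (u≋v (inject₁ i)) (*-congʳ (u≋v top))

  mulX-+ᵛ : ∀ u v → mulX (u +ᵛ v) ≋ mulX u +ᵛ mulX v
  mulX-+ᵛ u v zero    = distribʳ _ _ _
  mulX-+ᵛ u v (suc i) =
    solve 5 (λ x y z w c → (x :+ y) :+ (z :+ w) :* c := (x :+ z :* c) :+ (y :+ w :* c)) refl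
          (u (inject₁ i)) (v (inject₁ i)) (u top) (v top) (- a (suc i))

  mulX-*ᵛ : ∀ x v → mulX (x *ᵛ v) ≋ x *ᵛ mulX v
  mulX-*ᵛ x v zero    = *-assoc _ _ _
  mulX-*ᵛ x v (suc i) =
    solve 4 (λ x y z c → x :* y :+ x :* z :* c := x :* (y :+ z :* c)) refl
          x (v (inject₁ i)) (v top) (- a (suc i))

  mulX-0ᵛ : mulX 0ᵛ ≋ 0ᵛ
  mulX-0ᵛ zero    = zeroˡ _
  mulX-0ᵛ (suc i) = trans (+-identityˡ _) (zeroˡ _)

  -- act p v = p(t) · v in R[t]/(f) (Horner's rule), so red p is the remainder of p modulo f.
  act : UPoly → V → V
  act []      v = 0ᵛ
  act (b ∷ p) v = b *ᵛ v +ᵛ mulX (act p v)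

  red : UPoly → V
  red p = act p e₀

  act-congʳ : ∀ p {u v} → u ≋ v → act p u ≋ act p v
  act-congʳ []      u≋v i = refl
  act-congʳ (b ∷ p) u≋v i = +-cong (*-congˡ (u≋v i)) (mulX-cong (act-congʳ p u≋v) i)

  act-+ᵛ : ∀ p u v → act p (u +ᵛ v) ≋ act p u +ᵛ act p v
  act-+ᵛ []      u v i = sym (+-identityˡ 0#)
  act-+ᵛ (b ∷ p) u v i = begin
    b * (u i + v i) + mulX (act p (u +ᵛ v)) i
      ≈⟨ +-cong (distribˡ b (u i) (v i))
                (trans (mulX-cong (act-+ᵛ p u v) i) (mulX-+ᵛ (act p u) (act p v) i)) ⟩
    (b * u i + b * v i) + (mulX (act p u) i + mulX (act p v) i)
      ≈⟨ +-interchange _ _ _ _ ⟩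
    (b * u i + mulX (act p u) i) + (b * v i + mulX (act p v) i)
      ∎
    where open ≈-Reasoning

  act-*ᵛ : ∀ p x v → act p (x *ᵛ v) ≋ x *ᵛ act p v
  act-*ᵛ []      x v i = sym (zeroʳ x)
  act-*ᵛ (b ∷ p) x v i = begin
    b * (x * v i) + mulX (act p (x *ᵛ v)) i
      ≈⟨ +-congˡ (trans (mulX-cong (act-*ᵛ p x v) i) (mulX-*ᵛ x (act p v) i)) ⟩
    b * (x * v i) + x * mulX (act p v) i
      ≈⟨ solve 4 (λ b x y z → b :* (x :* y) :+ x :* z := x :* (b :* y :+ z)) refl b x (v i) _ ⟩
    x * (b * v i + mulX (act p v) i)
      ∎
    where open ≈-Reasoning

  act-0ᵛ : ∀ p → act p 0ᵛ ≋ 0ᵛ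
  act-0ᵛ []      i = refl
  act-0ᵛ (b ∷ p) i =
    trans (+-cong (zeroʳ b) (trans (mulX-cong (act-0ᵛ p) i) (mulX-0ᵛ i))) (+-identityˡ 0#)

  act-mulX : ∀ p v → act p (mulX v) ≋ mulX (act p v)
  act-mulX []      v = ≋-sym mulX-0ᵛ
  act-mulX (b ∷ p) v i = begin
    b * mulX v i + mulX (act p (mulX v)) i
      ≈⟨ +-cong (mulX-*ᵛ b v i) (mulX-cong (≋-sym (act-mulX p v)) i) ⟨
    mulX (b *ᵛ v) i + mulX (mulX (act p v)) i
      ≈⟨ mulX-+ᵛ (b *ᵛ v) (mulX (act p v)) i ⟨
    mulX (act (b ∷ p) v) i
      ∎
    where open ≈-Reasoning

  act-⊕ : ∀ p q v → act (p ⊕ q) v ≋ act p v +ᵛ act q v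
  act-⊕ []      q       v i = sym (+-identityˡ _)
  act-⊕ (b ∷ p) []      v i = sym (+-identityʳ _)
  act-⊕ (b ∷ p) (d ∷ q) v i = begin
    (b + d) * v i + mulX (act (p ⊕ q) v) i
      ≈⟨ +-cong (distribʳ (v i) b d)
                (trans (mulX-cong (act-⊕ p q v) i) (mulX-+ᵛ (act p v) (act q v) i)) ⟩
    (b * v i + d * v i) + (mulX (act p v) i + mulX (act q v) i)
      ≈⟨ +-interchange _ _ _ _ ⟩
    (b * v i + mulX (act p v) i) + (d * v i + mulX (act q v) i)
      ∎
    where open ≈-Reasoning

  act-⋆ : ∀ x p v → act (x ⋆ p) v ≋ x *ᵛ act p v
  act-⋆ x []      v i = sym (zeroʳ x)
  act-⋆ x (b ∷ p) v i = begin
    (x * b) * v i + mulX (act (x ⋆ p) v) i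
      ≈⟨ +-congˡ (trans (mulX-cong (act-⋆ x p v) i) (mulX-*ᵛ x (act p v) i)) ⟩
    (x * b) * v i + x * mulX (act p v) i
      ≈⟨ solve 4 (λ x b y z → (x :* b) :* y :+ x :* z := x :* (b :* y :+ z)) refl x b (v i) _ ⟩
    x * (b * v i + mulX (act p v) i)
      ∎
    where open ≈-Reasoning

  act-0∷ : ∀ p v → act (0# ∷ p) v ≋ mulX (act p v)
  act-0∷ p v i = trans (+-congʳ (zeroˡ (v i))) (+-identityˡ _)

  act-≐[] : ∀ {p} v → p ≐ [] → act p v ≋ 0ᵛ
  act-≐[] {[]}    v p≐[] = ≋-refl
  act-≐[] {b ∷ p} v p≐[] i = begin
    b * v i + mulX (act p v) i
      ≈⟨ +-cong (*-congʳ (coef-≈ p≐[] 0)) (mulX-cong (act-≐[] {p} v (coefwise (coef-≈ p≐[] ∘ suc))) i) ⟩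
    0# * v i + mulX 0ᵛ i       ≈⟨ +-cong (zeroˡ (v i)) (mulX-0ᵛ i) ⟩
    0# + 0#                    ≈⟨ +-identityˡ 0# ⟩
    0#                         ∎
    where open ≈-Reasoning

  act-≐ : ∀ {p q} v → p ≐ q → act p v ≋ act q v
  act-≐ {[]}    {q}     v p≐q = ≋-sym (act-≐[] v (≐-sym p≐q))
  act-≐ {b ∷ p} {[]}    v p≐q = act-≐[] v p≐q
  act-≐ {b ∷ p} {d ∷ q} v p≐q i =
    +-cong (*-congʳ (coef-≈ p≐q 0)) (mulX-cong (act-≐ {p} {q} v (coefwise (coef-≈ p≐q ∘ suc))) i)

  act-⊛ : ∀ p q v → act (p ⊛ q) v ≋ act q (act p v)
  act-⊛ []      q v = ≋-sym (act-0ᵛ q)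
  act-⊛ (b ∷ p) q v i = begin
    act (b ⋆ q ⊕ (0# ∷ p ⊛ q)) v i                 ≈⟨ act-⊕ (b ⋆ q) (0# ∷ p ⊛ q) v i ⟩
    act (b ⋆ q) v i + act (0# ∷ p ⊛ q) v i          ≈⟨ +-cong (act-⋆ b q v i) (act-0∷ (p ⊛ q) v i) ⟩
    b * act q v i + mulX (act (p ⊛ q) v) i          ≈⟨ +-congˡ (mulX-cong (act-⊛ p q v) i) ⟩
    b * act q v i + mulX (act q (act p v)) i        ≈⟨ +-cong (act-*ᵛ q b v i) (act-mulX q (act p v) i) ⟨
    act q (b *ᵛ v) i + act q (mulX (act p v)) i     ≈⟨ act-+ᵛ q (b *ᵛ v) (mulX (act p v)) i ⟨
    act q (act (b ∷ p) v) i                         ∎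
    where open ≈-Reasoning

  act-comm : ∀ p q v → act p (act q v) ≋ act q (act p v)
  act-comm p []      v = act-0ᵛ p
  act-comm p (b ∷ q) v i = begin
    act p (b *ᵛ v +ᵛ mulX (act q v)) i              ≈⟨ act-+ᵛ p (b *ᵛ v) (mulX (act q v)) i ⟩
    act p (b *ᵛ v) i + act p (mulX (act q v)) i     ≈⟨ +-cong (act-*ᵛ p b v i) (act-mulX p (act q v) i) ⟩
    b * act p v i + mulX (act p (act q v)) i        ≈⟨ +-congˡ (mulX-cong (act-comm p q v) i) ⟩
    b * act p v i + mulX (act q (act p v)) i        ∎
    where open ≈-Reasoning

  act-1 : ∀ v → act (1# ∷ []) v ≋ v
  act-1 v i = trans (+-cong (*-identityˡ (v i)) (mulX-0ᵛ i)) (+-identityʳ (v i))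

  red-⊛ : ∀ p q → red (p ⊛ q) ≋ act q (red p)
  red-⊛ p q = act-⊛ p q e₀

module ModuloF {c ℓ} (R : CommutativeRing c ℓ) (n′ : ℕ)
               (a : Fin (suc n′) → CommutativeRing.Carrier R) where
  open CommutativeRing R hiding (zero)
  open UnivariatePolynomial R
  open CompanionOperator R n′ a public
  open WeilDefs R using (A)

  infix 4 _∼_
  record _∼_ (p q : UPoly) : Set ℓ where
    constructor sameRed
    field red-≋ : red p ≋ red q
  open _∼_ public

  ∼-refl : ∀ {p} → p ∼ p
  ∼-refl = sameRed ≋-refl

  ∼-sym : ∀ {p q} → p ∼ q → q ∼ p
  ∼-sym (sameRed e) = sameRed (≋-sym e)

  ∼-trans : ∀ {p q r} → p ∼ q → q ∼ r → p ∼ r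
  ∼-trans (sameRed e) (sameRed e′) = sameRed (≋-trans e e′)

  ∼-reflexive : ∀ {p q} → p ≡ q → p ∼ q
  ∼-reflexive ≡.refl = ∼-refl

  ∼-setoid : Setoid c ℓ
  ∼-setoid = record
    { Carrier = UPoly ; _≈_ = _∼_
    ; isEquivalence = record { refl = ∼-refl ; sym = ∼-sym ; trans = ∼-trans } }

  module ∼-Reasoning = Relation.Binary.Reasoning.Setoid ∼-setoid
  module ≋-Reasoning = Relation.Binary.Reasoning.Setoid (≋-setoid N)

  ≐⇒∼ : ∀ {p q} → p ≐ q → p ∼ q
  ≐⇒∼ p≐q = sameRed (act-≐ e₀ p≐q)

  ⊛-comm : ∀ p q → p ⊛ q ∼ q ⊛ p
  ⊛-comm p q = sameRed (≋-trans (red-⊛ p q) (≋-trans (act-comm q p e₀) (≋-sym (red-⊛ q p))))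

  ⊛-cong : ∀ {p p′ q q′} → p ∼ p′ → q ∼ q′ → p ⊛ q ∼ p′ ⊛ q′
  ⊛-cong {p} {p′} {q} {q′} (sameRed p≋p′) (sameRed q≋q′) = sameRed (begin
    red (p ⊛ q)      ≈⟨ red-⊛ p q ⟩
    act q (red p)    ≈⟨ act-congʳ q p≋p′ ⟩
    act q (red p′)   ≈⟨ act-comm q p′ e₀ ⟩
    act p′ (red q)   ≈⟨ act-congʳ p′ q≋q′ ⟩
    act p′ (red q′)  ≈⟨ act-comm p′ q′ e₀ ⟩
    act q′ (red p′)  ≈⟨ red-⊛ p′ q′ ⟨
    red (p′ ⊛ q′)    ∎)
    where open ≋-Reasoning

  ⊛-congˡ : ∀ p {q q′} → q ∼ q′ → p ⊛ q ∼ p ⊛ q′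
  ⊛-congˡ p = ⊛-cong (∼-refl {p})

  ⊛-assoc : ∀ p q r → (p ⊛ q) ⊛ r ∼ p ⊛ (q ⊛ r)
  ⊛-assoc p q r = sameRed (begin
    red ((p ⊛ q) ⊛ r)      ≈⟨ red-⊛ (p ⊛ q) r ⟩
    act r (red (p ⊛ q))    ≈⟨ act-congʳ r (red-⊛ p q) ⟩
    act r (act q (red p))  ≈⟨ act-⊛ q r (red p) ⟨
    act (q ⊛ r) (red p)    ≈⟨ red-⊛ p (q ⊛ r) ⟨
    red (p ⊛ (q ⊛ r))      ∎)
    where open ≋-Reasoning

  ⊛-identityʳ : ∀ p → p ⊛ (1# ∷ []) ∼ p
  ⊛-identityʳ p = sameRed (≋-trans (red-⊛ p (1# ∷ [])) (act-1 (red p)))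

  ⊛-commutativeMonoid : CommutativeMonoid c ℓ
  ⊛-commutativeMonoid = record
    { Carrier = UPoly ; _≈_ = _∼_ ; _∙_ = _⊛_ ; ε = 1# ∷ []
    ; isCommutativeMonoid = record
      { isMonoid = record
        { isSemigroup = record
          { isMagma = record
            { isEquivalence = Setoid.isEquivalence ∼-setoid
            ; ∙-cong = ⊛-cong }
          ; assoc = ⊛-assoc }
        ; identity = (λ p → ∼-trans (⊛-comm (1# ∷ []) p) (⊛-identityʳ p)) , ⊛-identityʳ }
      ; comm = ⊛-comm } }

  ⊕-cong∼ : ∀ {p p′ q q′} → p ∼ p′ → q ∼ q′ → p ⊕ q ∼ p′ ⊕ q′
  ⊕-cong∼ {p} {p′} {q} {q′} (sameRed p≋p′) (sameRed q≋q′) = sameRed λ i →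
    trans (act-⊕ p q e₀ i) (trans (+-cong (p≋p′ i) (q≋q′ i)) (sym (act-⊕ p′ q′ e₀ i)))

  ⊛-[] : ∀ p → p ⊛ [] ∼ []
  ⊛-[] p = sameRed (red-⊛ p [])

  ⊛-distribʳ : ∀ p q r → (p ⊕ q) ⊛ r ∼ p ⊛ r ⊕ q ⊛ r
  ⊛-distribʳ p q r = sameRed (begin
    red ((p ⊕ q) ⊛ r)                      ≈⟨ red-⊛ (p ⊕ q) r ⟩
    act r (red (p ⊕ q))                    ≈⟨ act-congʳ r (act-⊕ p q e₀) ⟩
    act r (red p +ᵛ red q)                 ≈⟨ act-+ᵛ r (red p) (red q) ⟩
    act r (red p) +ᵛ act r (red q)         ≈⟨ (λ i → +-cong (red-⊛ p r i) (red-⊛ q r i)) ⟨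
    red (p ⊛ r) +ᵛ red (q ⊛ r)             ≈⟨ act-⊕ (p ⊛ r) (q ⊛ r) e₀ ⟨
    red (p ⊛ r ⊕ q ⊛ r)                    ∎)
    where open ≋-Reasoning

  module _ {x} {X : Set x} where

    ∑-cong∼ : ∀ {xs : List X} {F G} → All (λ x → F x ∼ G x) xs → ∑ xs F ∼ ∑ xs G
    ∑-cong∼ []             = ∼-refl
    ∑-cong∼ (Fx∼Gx ∷ F∼G) = ⊕-cong∼ Fx∼Gx (∑-cong∼ F∼G)

    ∑-⊛ : ∀ (xs : List X) F q → ∑ xs F ⊛ q ∼ ∑[ x ← xs ] (F x ⊛ q)
    ∑-⊛ []       F q = ∼-refl
    ∑-⊛ (x ∷ xs) F q =
      ∼-trans (⊛-distribʳ (F x) (∑ xs F) q) (⊕-cong∼ ∼-refl (∑-⊛ xs F q))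

    ⊛-∑ : ∀ p (xs : List X) F → p ⊛ ∑ xs F ∼ ∑[ x ← xs ] (p ⊛ F x)
    ⊛-∑ p xs F = ∼-trans (⊛-comm p (∑ xs F))
      (∼-trans (∑-⊛ xs F p) (∑-cong∼ (All.universal (λ x → ⊛-comm (F x) p) xs)))

  α : ℕ → Carrier
  α = A N a

  α-toℕ : ∀ i → α (toℕ i) ≡ a i
  α-toℕ i with toℕ i ℕ.<? N
  ... | yes i<N = ≡.cong a (fromℕ<-toℕ i i<N)
  ... | no  i≮N = contradiction (toℕ<n i) i≮N

  α-N : α N ≡ 1#
  α-N with N ℕ.<? N
  ... | yes N<N = contradiction N<N (ℕ.n≮n N)
  ... | no  _ with N ℕ.≟ N
  ...   | yes _   = ≡.refl
  ...   | no  N≢N = contradiction ≡.refl N≢N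

  α-> : ∀ {k} → N ℕ.< k → α k ≡ 0#
  α-> {k} N<k with k ℕ.<? N
  ... | yes k<N = contradiction N<k (ℕ.<-asym k<N)
  ... | no  _ with k ℕ.≟ N
  ...   | yes k≡N = contradiction (≡.sym k≡N) (ℕ.<⇒≢ N<k)
  ...   | no  _   = ≡.refl

  D : ℕ → UPoly
  D x = applyUpTo (λ k → α (suc (x ℕ.+ k))) N

  𝔣 : UPoly
  𝔣 = applyUpTo α (suc N)

  Reduced : UPoly → Set ℓ
  Reduced p = ∀ k → N ℕ.≤ k → coef p k ≈ 0#

  coef-D : ∀ x k → coef (D x) k ≈ α (suc (x ℕ.+ k))
  coef-D x k with k ℕ.<? N
  ... | yes k<N = reflexive (coef-applyUpTo-< (λ k → α (suc (x ℕ.+ k))) k<N)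
  ... | no  k≮N = reflexive (≡.trans (coef-applyUpTo-≥ (λ k → α (suc (x ℕ.+ k))) N≤k) (≡.sym (α-> N<)))
    where
    N≤k = ℕ.≮⇒≥ k≮N
    N< = ℕ.s≤s (ℕ.≤-trans N≤k (ℕ.m≤n+m k x))

  D-reduced : ∀ x → Reduced (D x)
  D-reduced x k N≤k = reflexive (coef-applyUpTo-≥ (λ k → α (suc (x ℕ.+ k))) N≤k)

  reduced-tail : ∀ {b p} → Reduced (b ∷ p) → Reduced p
  reduced-tail b∷p-r k N≤k = b∷p-r (suc k) (ℕ.m≤n⇒m≤1+n N≤k)

  red-reduced : ∀ p → Reduced p → ∀ i → red p i ≈ coef p (toℕ i)
  red-tail-top : ∀ {b} p → Reduced (b ∷ p) → red p top ≈ 0#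

  red-reduced []      _     i = refl
  red-reduced (b ∷ p) b∷p-r zero = begin
    b * 1# + red p top * - a zero
      ≈⟨ +-cong (*-identityʳ b) (trans (*-congʳ (red-tail-top p b∷p-r)) (zeroˡ _)) ⟩
    b + 0#
      ≈⟨ +-identityʳ b ⟩
    b
      ∎
    where open ≈-Reasoning
  red-reduced (b ∷ p) b∷p-r (suc i) = begin
    b * 0# + (red p (inject₁ i) + red p top * - a (suc i))
      ≈⟨ +-cong (zeroʳ b) (+-cong (red-reduced p (reduced-tail b∷p-r) (inject₁ i))
                                   (trans (*-congʳ (red-tail-top p b∷p-r)) (zeroˡ _))) ⟩
    0# + (coef p (toℕ (inject₁ i)) + 0#)
      ≈⟨ trans (+-identityˡ _) (+-identityʳ _) ⟩
    coef p (toℕ (inject₁ i))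
      ≡⟨ ≡.cong (coef p) (toℕ-inject₁ i) ⟩
    coef p (toℕ i)
      ∎
    where open ≈-Reasoning

  red-tail-top {b} p b∷p-r = begin
    red p top          ≈⟨ red-reduced p (reduced-tail b∷p-r) top ⟩
    coef p (toℕ top)   ≡⟨ ≡.cong (coef p) (toℕ-fromℕ n′) ⟩
    coef (b ∷ p) N     ≈⟨ b∷p-r N ℕ.≤-refl ⟩
    0#                 ∎
    where open ≈-Reasoning

  red-D : ∀ x i → red (D x) i ≈ α (suc (x ℕ.+ toℕ i))
  red-D x i = trans (red-reduced (D x) (D-reduced x) i) (coef-D x (toℕ i))

  red-D-top-zero : red (D 0) top ≈ 1#
  red-D-top-zero = trans (red-D 0 top) (reflexive (≡.trans (≡.cong (α ∘ suc) (toℕ-fromℕ n′)) α-N))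

  red-D-top-suc : ∀ x → red (D (suc x)) top ≈ 0#
  red-D-top-suc x = trans (red-D (suc x) top) (reflexive (α-> N<))
    where
    N< : N ℕ.< suc (suc x ℕ.+ toℕ top)
    N< = ≡.subst (λ t → N ℕ.< suc (suc x ℕ.+ t)) (≡.sym (toℕ-fromℕ n′))
                 (ℕ.s≤s (ℕ.s≤s (ℕ.m≤n+m n′ x)))

  mulX-red-D-zero : mulX (red (D 0)) ≋ (- a zero) *ᵛ e₀
  mulX-red-D-zero zero    = trans (*-congʳ red-D-top-zero) (trans (*-identityˡ _) (sym (*-identityʳ _)))
  mulX-red-D-zero (suc i) = begin
    red (D 0) (inject₁ i) + red (D 0) top * - a (suc i)
      ≈⟨ +-cong (red-D 0 (inject₁ i)) (*-congʳ red-D-top-zero) ⟩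
    α (suc (toℕ (inject₁ i))) + 1# * - a (suc i)
      ≡⟨ ≡.cong (λ t → α (suc t) + 1# * - a (suc i)) (toℕ-inject₁ i) ⟩
    α (toℕ (suc i)) + 1# * - a (suc i)
      ≈⟨ +-cong (reflexive (α-toℕ (suc i))) (*-identityˡ _) ⟩
    a (suc i) + - a (suc i)
      ≈⟨ -‿inverseʳ (a (suc i)) ⟩
    0#
      ≈⟨ zeroʳ _ ⟨
    - a zero * 0#
      ∎
    where open ≈-Reasoning

  mulX-red-D-suc : ∀ x → mulX (red (D (suc x))) ≋ red (D x) +ᵛ (- α (suc x)) *ᵛ e₀
  mulX-red-D-suc x zero = begin
    red (D (suc x)) top * - a zero
      ≈⟨ trans (*-congʳ (red-D-top-suc x)) (zeroˡ _) ⟩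
    0#
      ≈⟨ -‿inverseʳ (α (suc x)) ⟨
    α (suc x) + - α (suc x)
      ≈⟨ +-cong (trans (red-D x zero) (reflexive (≡.cong (α ∘ suc) (ℕ.+-identityʳ x)))) (*-identityʳ _) ⟨
    red (D x) zero + - α (suc x) * 1#
      ∎
    where open ≈-Reasoning
  mulX-red-D-suc x (suc i) = begin
    red (D (suc x)) (inject₁ i) + red (D (suc x)) top * - a (suc i)
      ≈⟨ +-cong (red-D (suc x) (inject₁ i)) (trans (*-congʳ (red-D-top-suc x)) (zeroˡ _)) ⟩
    α (suc (suc x ℕ.+ toℕ (inject₁ i))) + 0#
      ≡⟨ ≡.cong (λ t → α (suc t) + 0#)
                (≡.trans (≡.cong (suc x ℕ.+_) (toℕ-inject₁ i)) (≡.sym (ℕ.+-suc x (toℕ i)))) ⟩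
    α (suc (x ℕ.+ toℕ (suc i))) + 0#
      ≈⟨ +-cong (red-D x (suc i)) (zeroʳ _) ⟨
    red (D x) (suc i) + - α (suc x) * 0#
      ∎
    where open ≈-Reasoning

  𝔣∼[] : 𝔣 ∼ []
  𝔣∼[] = sameRed λ i → begin
    α 0 * e₀ i + mulX (red (D 0)) i
      ≈⟨ +-cong (*-congʳ (reflexive (α-toℕ zero))) (mulX-red-D-zero i) ⟩
    a zero * e₀ i + - a zero * e₀ i
      ≈⟨ distribʳ (e₀ i) (a zero) (- a zero) ⟨
    (a zero + - a zero) * e₀ i
      ≈⟨ *-congʳ (-‿inverseʳ (a zero)) ⟩
    0# * e₀ i
      ≈⟨ zeroˡ (e₀ i) ⟩
    0#
      ∎
    where open ≈-Reasoning

  act-red-D-top : ∀ p → Reduced p → ∀ {j} → j ℕ.< N → act p (red (D j)) top ≈ coef p j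
  act-red-D-top []      _     _   = refl
  act-red-D-top (b ∷ p) b∷p-r {zero} _ = begin
    b * red (D 0) top + mulX (act p (red (D 0))) top
      ≈⟨ +-cong (*-congˡ red-D-top-zero) (sym (act-mulX p (red (D 0)) top)) ⟩
    b * 1# + act p (mulX (red (D 0))) top
      ≈⟨ +-cong (*-identityʳ b) (act-congʳ p mulX-red-D-zero top) ⟩
    b + act p ((- a zero) *ᵛ e₀) top
      ≈⟨ +-congˡ (act-*ᵛ p (- a zero) e₀ top) ⟩
    b + - a zero * red p top
      ≈⟨ +-congˡ (trans (*-congˡ (red-tail-top p b∷p-r)) (zeroʳ _)) ⟩
    b + 0#
      ≈⟨ +-identityʳ b ⟩
    b
      ∎
    where open ≈-Reasoning
  act-red-D-top (b ∷ p) b∷p-r {suc j} j<N = begin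
    b * red (D (suc j)) top + mulX (act p (red (D (suc j)))) top
      ≈⟨ +-cong (*-congˡ (red-D-top-suc j)) (sym (act-mulX p (red (D (suc j))) top)) ⟩
    b * 0# + act p (mulX (red (D (suc j)))) top
      ≈⟨ +-cong (zeroʳ b) (act-congʳ p (mulX-red-D-suc j) top) ⟩
    0# + act p (red (D j) +ᵛ (- α (suc j)) *ᵛ e₀) top
      ≈⟨ trans (+-identityˡ _) (act-+ᵛ p (red (D j)) _ top) ⟩
    act p (red (D j)) top + act p ((- α (suc j)) *ᵛ e₀) top
      ≈⟨ +-congˡ (act-*ᵛ p (- α (suc j)) e₀ top) ⟩
    act p (red (D j)) top + - α (suc j) * red p top
      ≈⟨ +-cong (act-red-D-top p (reduced-tail b∷p-r) (ℕ.<-trans (ℕ.n<1+n j) j<N))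
                (trans (*-congˡ (red-tail-top p b∷p-r)) (zeroʳ _)) ⟩
    coef p j + 0#
      ≈⟨ +-identityʳ _ ⟩
    coef p j
      ∎
    where open ≈-Reasoning

  τ : UPoly → Carrier
  τ p = red p top

  -- The D_f(t^j), j < N, are the basis dual to 1, t, …, t^{N-1} under the functional τ.
  τ-D⊛ : ∀ p → Reduced p → ∀ {j} → j ℕ.< N → τ (D j ⊛ p) ≈ coef p j
  τ-D⊛ p p-r {j} j<N = trans (red-⊛ (D j) p top) (act-red-D-top p p-r j<N)

  τ-cong : ∀ {p q} → p ∼ q → τ p ≈ τ q
  τ-cong p∼q = red-≋ p∼q top

module WeilSlices {c ℓ} (R : CommutativeRing c ℓ) (n′ : ℕ)
                  (a : Fin (suc n′) → CommutativeRing.Carrier R) where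
  open CommutativeRing R hiding (zero)
  open UnivariatePolynomial R
  open ModuloF R n′ a
  open ExponentVectors R
  open Slices R
  open WeilDefs R using (Poly; _*P_; unit; O2; fAt; oneP)
  open import Algebra.Properties.CommutativeMonoid.Sum ⊛-commutativeMonoid
    using (sum-cong-≋) renaming (sum to ∏)

  private variable k : ℕ

  termSlice-⊗-≤ : ∀ {e′ u : Vec ℕ k} b s t → (∀ i → lookup u i ≤ lookup e′ i) →
                  termSlice e′ ((b , u ∷ʳ s) ⊗ t) ∼ monomial b s ⊛ termSlice (zipWith _∸_ e′ u) t
  termSlice-⊗-≤ {e′ = e′} {u} b s (d , m) u≤e′
    with init (zipWith ℕ._+_ (u ∷ʳ s) m) ≟ᵥ e′ | init m ≟ᵥ zipWith _∸_ e′ u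
  ... | yes _  | yes _  = ≐⇒∼ (≐-trans (≐-reflexive (cong (monomial (b * d)) (last-∷ʳ-+ u s m)))
                                        (≐-sym (monomial-⊛ b d s (last m))))
  ... | yes eq | no ne  = contradiction (Equivalence.to (init-∷ʳ-+-≡⇔ s m u≤e′) eq) ne
  ... | no ne  | yes eq = contradiction (Equivalence.from (init-∷ʳ-+-≡⇔ s m u≤e′) eq) ne
  ... | no _   | no _   = ∼-sym (⊛-[] (monomial b s))

  termSlice-⊗-≰ : ∀ {e′ u : Vec ℕ k} b s t i → lookup e′ i < lookup u i →
                  termSlice e′ ((b , u ∷ʳ s) ⊗ t) ≡ []
  termSlice-⊗-≰ {e′ = e′} {u} b s (d , m) i e′<u with init (zipWith ℕ._+_ (u ∷ʳ s) m) ≟ᵥ e′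
  ... | yes eq = contradiction (≡.trans (≡.sym (init-∷ʳ-+ u s m)) eq) (+-≢ (init m) i e′<u)
  ... | no  _  = ≡.refl

  ∑termSlice-⊗-≤ : ∀ {e′ u : Vec ℕ k} b s Q → (∀ i → lookup u i ≤ lookup e′ i) →
                   ∑[ t ← Q ] termSlice e′ ((b , u ∷ʳ s) ⊗ t)
                   ∼ monomial b s ⊛ slice Q (zipWith _∸_ e′ u)
  ∑termSlice-⊗-≤ b s Q u≤e′ = ∼-trans (∑-cong∼ (All.universal (λ t → termSlice-⊗-≤ b s t u≤e′) Q))
                                      (∼-sym (⊛-∑ (monomial b s) Q _))

  ∑termSlice-⊗-≰ : ∀ {e′ u : Vec ℕ k} b s Q i → lookup e′ i < lookup u i →
                   ∑[ t ← Q ] termSlice e′ ((b , u ∷ʳ s) ⊗ t) ∼ []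
  ∑termSlice-⊗-≰ b s Q i e′<u = ≐⇒∼ (∑-[] Q (≐-reflexive ∘ λ t → termSlice-⊗-≰ b s t i e′<u))

  slice-*P-factor : ∀ {P Q : Poly (suc k)} {e′ u e″} →
                    All (λ t → ∑[ s ← Q ] termSlice e′ (t ⊗ s) ∼ termSlice u t ⊛ slice Q e″) P →
                    slice (P *P Q) e′ ∼ slice P u ⊛ slice Q e″
  slice-*P-factor {P = P} {Q} {e′} {u} {e″} factors = begin
    slice (P *P Q) e′                          ≈⟨ ≐⇒∼ (slice-*P P Q e′) ⟩
    ∑[ t ← P ] ∑[ s ← Q ] termSlice e′ (t ⊗ s) ≈⟨ ∑-cong∼ factors ⟩
    ∑[ t ← P ] (termSlice u t ⊛ slice Q e″)    ≈⟨ ∑-⊛ P (termSlice u) (slice Q e″) ⟨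
    slice P u ⊛ slice Q e″                     ∎
    where open ∼-Reasoning

  slice-fAt : ∀ k → slice (fAt N a (fromℕ k)) (replicate k 0) ≐ 𝔣
  slice-fAt k = begin
    slice (fAt N a (fromℕ k)) (replicate k 0)
      ≡⟨ ∑-map (λ s → (α s , unit (fromℕ k) s)) (upTo (suc N)) (termSlice (replicate k 0)) ⟩
    ∑[ s ← upTo (suc N) ] termSlice (replicate k 0) (α s , unit (fromℕ k) s)
      ≈⟨ ∑-cong (upTo (suc N)) (≐-reflexive ∘ term) ⟩
    ∑[ s ← upTo (suc N) ] monomial (α s) s
      ≈⟨ ∑-monomials α (suc N) ⟩
    𝔣
      ∎
    where
    open ≐-Reasoning
    term : ∀ s → termSlice (replicate k 0) (α s , unit (fromℕ k) s) ≡ monomial (α s) s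
    term s = ≡.trans (cong (termSlice (replicate k 0) ∘ (α s ,_)) (unit-fromℕ k s))
                     (termSlice-∷ʳ-≡ (replicate k 0) (α s) s)

  slice-fAt-*P∼[] : ∀ {k} (H : Poly (suc k)) e′ → slice (fAt N a (fromℕ k) *P H) e′ ∼ []
  slice-fAt-*P∼[] {k} H e′ = begin
    slice (F *P H) e′
      ≈⟨ slice-*P-factor {P = F} {H} {e′} {replicate k 0} {e′} factors ⟩
    slice F (replicate k 0) ⊛ slice H e′
      ≈⟨ ⊛-cong (≐⇒∼ (slice-fAt k)) ∼-refl ⟩
    𝔣 ⊛ slice H e′
      ≈⟨ ⊛-cong 𝔣∼[] ∼-refl ⟩
    [] ⊛ slice H e′
      ∎
    where
    open ∼-Reasoning
    F = fAt N a (fromℕ k)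
    factor : ∀ s → ∑[ t ← H ] termSlice e′ ((α s , unit (fromℕ k) s) ⊗ t)
                   ∼ termSlice (replicate k 0) (α s , unit (fromℕ k) s) ⊛ slice H e′
    factor s rewrite unit-fromℕ k s | termSlice-∷ʳ-≡ (replicate k 0) (α s) s =
      ≡.subst (λ e → ∑[ t ← H ] termSlice e′ ((α s , replicate k 0 ∷ʳ s) ⊗ t) ∼ monomial (α s) s ⊛ slice H e)
              (∸-replicate-0 e′) (∑termSlice-⊗-≤ (α s) s H 0≤e′)
      where 0≤e′ = λ i → ≡.subst (_≤ lookup e′ i) (≡.sym (lookup-replicate i 0)) z≤n
    factors = map⁺ (All.universal factor (upTo (suc N)))

  O2-last : Fin k → Poly (suc k)
  O2-last {k} h = O2 N a (inject₁ h) (fromℕ k)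

  O2-term : Fin k → ℕ → ℕ → Term (suc k)
  O2-term {k} h s l = (α (s ℕ.+ l ℕ.+ 1) , zipWith ℕ._+_ (unit (inject₁ h) l) (unit (fromℕ k) s))

  slice-O2-last : ∀ (h : Fin k) x → slice (O2-last h) (unit h x) ≐ D x
  slice-O2-last h x = begin
    slice (O2-last h) (unit h x)
      ≈⟨ ∑-concatMap (λ s → map (O2-term h s) (upTo (N ∸ s))) (upTo N) (termSlice (unit h x)) ⟩
    ∑[ s ← upTo N ] ∑ (map (O2-term h s) (upTo (N ∸ s))) (termSlice (unit h x))
      ≈⟨ ∑-cong (upTo N) (λ s → ≐-trans (≐-reflexive (∑-map (O2-term h s) (upTo (N ∸ s)) _))
                                         (∑-cong (upTo (N ∸ s)) (term s))) ⟩
    ∑[ s ← upTo N ] ∑[ l ← upTo (N ∸ s) ] (if does (l ℕ.≟ x) then monomial (α (s ℕ.+ l ℕ.+ 1)) s else [])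
      ≈⟨ ∑-cong (upTo N) (λ s → ∑-δ (λ l → monomial (α (s ℕ.+ l ℕ.+ 1)) s) x (N ∸ s)) ⟩
    ∑[ s ← upTo N ] (if does (x ℕ.<? N ∸ s) then monomial (α (s ℕ.+ x ℕ.+ 1)) s else [])
      ≈⟨ ∑-cong (upTo N) (λ s → drop-bound s (x ℕ.<? N ∸ s)) ⟩
    ∑[ s ← upTo N ] monomial (α (suc (x ℕ.+ s))) s
      ≈⟨ ∑-monomials _ N ⟩
    D x
      ∎
    where
    open ≐-Reasoning
    term : ∀ s l → termSlice (unit h x) (O2-term h s l)
                   ≐ (if does (l ℕ.≟ x) then monomial (α (s ℕ.+ l ℕ.+ 1)) s else [])
    term s l = begin
      termSlice (unit h x) (O2-term h s l)
        ≡⟨ cong (termSlice (unit h x) ∘ (αₛₗ ,_)) (unit-inject₁+unit-fromℕ h l s) ⟩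
      termSlice (unit h x) (αₛₗ , unit h l ∷ʳ s)
        ≡⟨ termSlice-∷ʳ (unit h x) (unit h l) αₛₗ s ⟩
      (if does (unit h l ≟ᵥ unit h x) then monomial αₛₗ s else [])
        ≡⟨ cong (λ β → if β then monomial αₛₗ s else []) (does-⇔ l≡x⇔ (unit h l ≟ᵥ unit h x) (l ℕ.≟ x)) ⟩
      (if does (l ℕ.≟ x) then monomial αₛₗ s else [])
        ∎
      where
      αₛₗ = α (s ℕ.+ l ℕ.+ 1)
      l≡x⇔ = mk⇔ (unit-injective h) (cong (unit h))
    drop-bound : ∀ s → (x<N∸s : Dec (x < N ∸ s)) →
                 (if does x<N∸s then monomial (α (s ℕ.+ x ℕ.+ 1)) s else [])
                 ≐ monomial (α (suc (x ℕ.+ s))) s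
    drop-bound s (yes _)    = ≐-reflexive (cong (λ t → monomial (α t) s)
                                                (≡.trans (ℕ.+-comm (s ℕ.+ x) 1) (cong suc (ℕ.+-comm s x))))
    drop-bound s (no x≮N∸s) =
      ≐-sym (≐-trans (≐-reflexive (cong (λ b → monomial b s) (α-> N<))) (monomial-0# s))
      where N< = ℕ.≰⇒> (x≮N∸s ∘ ℕ.m+n≤o⇒m≤o∸n (suc x))

  -- Q does not involve X_h, up to multiples of f(X_{k+1}).
  FreeOf : Fin k → Poly (suc k) → Set ℓ
  FreeOf h Q = ∀ e″ → lookup e″ h ≢ 0 → slice Q e″ ∼ []

  slice-O2-last-*P : ∀ (h : Fin k) Q → FreeOf h Q →
                     ∀ e′ → slice (O2-last h *P Q) e′ ∼ D (lookup e′ h) ⊛ slice Q (e′ [ h ]≔ 0)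
  slice-O2-last-*P {k} h Q Q-free e′ = begin
    slice (O2-last h *P Q) e′
      ≈⟨ slice-*P-factor {P = O2-last h} {Q} {e′} {unit h x} {e′ [ h ]≔ 0} factors ⟩
    slice (O2-last h) (unit h x) ⊛ slice Q (e′ [ h ]≔ 0)
      ≈⟨ ⊛-cong (≐⇒∼ (slice-O2-last h x)) ∼-refl ⟩
    D x ⊛ slice Q (e′ [ h ]≔ 0)
      ∎
    where
    open ∼-Reasoning
    x = lookup e′ h
    factor : ∀ s l → ∑[ t ← Q ] termSlice e′ (O2-term h s l ⊗ t)
                     ∼ termSlice (unit h x) (O2-term h s l) ⊛ slice Q (e′ [ h ]≔ 0)
    factor s l rewrite unit-inject₁+unit-fromℕ h l s with ℕ.<-cmp l x
    ... | tri< l<x l≢x _ rewrite termSlice-∷ʳ-≢ (α (s ℕ.+ l ℕ.+ 1)) s (l≢x ∘ unit-injective h) = begin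
      ∑[ t ← Q ] termSlice e′ ((αₛₗ , unit h l ∷ʳ s) ⊗ t)
        ≈⟨ ∑termSlice-⊗-≤ αₛₗ s Q (unit-≤ h e′ (ℕ.<⇒≤ l<x)) ⟩
      monomial αₛₗ s ⊛ slice Q (zipWith _∸_ e′ (unit h l))
        ≈⟨ ⊛-congˡ (monomial αₛₗ s) (Q-free _ (ℕ.m>n⇒m∸n≢0 l<x ∘ ≡.trans (≡.sym (lookup-∸-unit e′ h l)))) ⟩
      monomial αₛₗ s ⊛ []
        ≈⟨ ⊛-[] (monomial αₛₗ s) ⟩
      []
        ∎
      where αₛₗ = α (s ℕ.+ l ℕ.+ 1)
    ... | tri≈ _ ≡.refl _ rewrite termSlice-∷ʳ-≡ (unit h x) (α (s ℕ.+ x ℕ.+ 1)) s =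
      ≡.subst (λ e → ∑[ t ← Q ] termSlice e′ ((αₛₗ , unit h x ∷ʳ s) ⊗ t) ∼ monomial αₛₗ s ⊛ slice Q e)
              (∸-unit-lookup e′ h) (∑termSlice-⊗-≤ αₛₗ s Q (unit-≤ h e′ ℕ.≤-refl))
      where αₛₗ = α (s ℕ.+ x ℕ.+ 1)
    ... | tri> _ l≢x x<l rewrite termSlice-∷ʳ-≢ (α (s ℕ.+ l ℕ.+ 1)) s (l≢x ∘ unit-injective h) =
      ∑termSlice-⊗-≰ _ s Q h (≡.subst (x <_) (≡.sym (lookup-unit-≡ h l)) x<l)
    factors = concat⁺ (map⁺ (All.universal (λ s → map⁺ (All.universal (factor s) (upTo (N ∸ s))))
                                           (upTo N)))

  ∏O2 : ∀ {k′} → (Fin k′ → Fin k) → Poly (suc k)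
  ∏O2 h = foldr _*P_ oneP (List.tabulate (O2-last ∘ h))

  O2-product : ∀ k → Poly (suc k)
  O2-product k = foldr _*P_ oneP (map (λ j → O2 N a (inject₁ j) (fromℕ k)) (allFin k))

  slice-oneP : ∀ (e′ : Vec ℕ k) → slice oneP e′ ≡ termSlice e′ (1# , replicate k 0 ∷ʳ 0)
  slice-oneP {k} e′ = ≡.trans (⊕-identityʳ _) (cong (termSlice e′ ∘ (1# ,_)) (replicate-∷ʳ k 0))

  h-suc≢h-zero : ∀ {k′} (h : Fin (suc k′) → Fin k) → Injective _≡_ _≡_ h → ∀ i → h (suc i) ≢ h zero
  h-suc≢h-zero h h-inj i eq = 0≢1+n (≡.sym (h-inj eq))

  ∏O2-freeOf : ∀ {k′} (h : Fin k′ → Fin k) → Injective _≡_ _≡_ h →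
               ∀ j → (∀ i → h i ≢ j) → FreeOf j (∏O2 h)
  ∏O2-freeOf {k′ = zero} h _ j _ e″ e″ⱼ≢0 =
    ≐⇒∼ (≐-reflexive (≡.trans (slice-oneP e″) (termSlice-∷ʳ-≢ 1# 0 0≢e″)))
    where
    0≢e″ = λ 0≡e″ → e″ⱼ≢0 (≡.trans (cong (λ v → lookup v j) (≡.sym 0≡e″)) (lookup-replicate j 0))
  ∏O2-freeOf {k′ = suc k′} h h-inj j j∉h e″ e″ⱼ≢0 = begin
    slice (O2-last (h zero) *P ∏O2 rest) e″
      ≈⟨ slice-O2-last-*P (h zero) (∏O2 rest) rest-free e″ ⟩
    D (lookup e″ (h zero)) ⊛ slice (∏O2 rest) (e″ [ h zero ]≔ 0)
      ≈⟨ ⊛-congˡ (D (lookup e″ (h zero))) (∏O2-freeOf rest rest-inj j (j∉h ∘ suc) _ cleared-e″ⱼ≢0) ⟩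
    D (lookup e″ (h zero)) ⊛ []
      ≈⟨ ⊛-[] (D (lookup e″ (h zero))) ⟩
    []
      ∎
    where
    open ∼-Reasoning
    rest = h ∘ suc
    rest-inj : Injective _≡_ _≡_ rest
    rest-inj = suc-injective ∘ h-inj
    rest-free = ∏O2-freeOf rest rest-inj (h zero) (h-suc≢h-zero h h-inj)
    cleared-e″ⱼ≢0 = e″ⱼ≢0 ∘ ≡.trans (≡.sym (lookup∘update′ (j∉h zero ∘ ≡.sym) e″ 0))

  slice-∏O2 : ∀ {k′} (h : Fin k′ → Fin k) → Injective _≡_ _≡_ h →
              ∀ e′ → (∀ j → (∀ i → h i ≢ j) → lookup e′ j ≡ 0) →
              slice (∏O2 h) e′ ∼ ∏ (D ∘ lookup e′ ∘ h)
  slice-∏O2 {k} {k′ = zero} h _ e′ e′-vanishes = ≐⇒∼ (≐-reflexive (begin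
    slice oneP e′
      ≡⟨ slice-oneP e′ ⟩
    termSlice e′ (1# , replicate k 0 ∷ʳ 0)
      ≡⟨ cong (λ e → termSlice e (1# , replicate k 0 ∷ʳ 0)) e′≡0 ⟩
    termSlice (replicate k 0) (1# , replicate k 0 ∷ʳ 0)
      ≡⟨ termSlice-∷ʳ-≡ (replicate k 0) 1# 0 ⟩
    1# ∷ []
      ∎))
    where
    open ≡.≡-Reasoning
    e′≡0 : e′ ≡ replicate k 0
    e′≡0 = lookup-ext λ j → ≡.trans (e′-vanishes j (λ ())) (≡.sym (lookup-replicate j 0))
  slice-∏O2 {k′ = suc k′} h h-inj e′ e′-vanishes = begin
    slice (O2-last (h zero) *P ∏O2 rest) e′
      ≈⟨ slice-O2-last-*P (h zero) (∏O2 rest) rest-free e′ ⟩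
    D (lookup e′ (h zero)) ⊛ slice (∏O2 rest) (e′ [ h zero ]≔ 0)
      ≈⟨ ⊛-congˡ (D (lookup e′ (h zero))) (slice-∏O2 rest rest-inj (e′ [ h zero ]≔ 0) cleared-vanishes) ⟩
    D (lookup e′ (h zero)) ⊛ ∏ (D ∘ lookup (e′ [ h zero ]≔ 0) ∘ rest)
      ≈⟨ ⊛-congˡ (D (lookup e′ (h zero))) (sum-cong-≋ λ i → ∼-reflexive (cong D (lookup-cleared i))) ⟩
    D (lookup e′ (h zero)) ⊛ ∏ (D ∘ lookup e′ ∘ rest)
      ∎
    where
    open ∼-Reasoning
    rest = h ∘ suc
    rest-inj : Injective _≡_ _≡_ rest
    rest-inj = suc-injective ∘ h-inj
    rest-free = ∏O2-freeOf rest rest-inj (h zero) (h-suc≢h-zero h h-inj)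
    lookup-cleared : ∀ i → lookup (e′ [ h zero ]≔ 0) (rest i) ≡ lookup e′ (rest i)
    lookup-cleared i = lookup∘update′ (h-suc≢h-zero h h-inj i) e′ 0
    cleared-vanishes : ∀ j → (∀ i → rest i ≢ j) → lookup (e′ [ h zero ]≔ 0) j ≡ 0
    cleared-vanishes j j∉rest with j Fin.≟ h zero
    ... | yes ≡.refl = lookup∘update (h zero) e′ 0
    ... | no  j≢h₀   = ≡.trans (lookup∘update′ j≢h₀ e′ 0)
                               (e′-vanishes j λ { zero → j≢h₀ ∘ ≡.sym ; (suc i) → j∉rest i })

  slice-O2-product : ∀ k e′ → slice (O2-product k) e′ ∼ ∏ (D ∘ lookup e′)
  slice-O2-product k e′ rewrite List.map-tabulate {n = k} (λ i → i) (O2-last {k}) =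
    slice-∏O2 (λ i → i) (λ eq → eq) e′ (λ j j∉ → contradiction ≡.refl (j∉ j))

module WeilSymmetry {c ℓ} (R : CommutativeRing c ℓ) (n′ : ℕ)
                    (a : Fin (suc n′) → CommutativeRing.Carrier R) where
  open CommutativeRing R hiding (zero)
  open UnivariatePolynomial R
  open ModuloF R n′ a
  open ExponentVectors R
  open Slices R
  open WeilSlices R n′ a
  open WeilDefs R using (Poly; coeff; DegLt; Symmetric; IsWeilOperator; oneP; O2; unit; fAt; _*P_; _+P_)
  open import Algebra.Properties.CommutativeMonoid.Sum ⊛-commutativeMonoid
    using (sum-cong-≋; sum-init-last; sum-permute) renaming (sum to ∏)

  private variable k : ℕ

  HasProductSlices : Poly (suc k) → Set ℓ
  HasProductSlices P = ∀ e′ → slice P e′ ∼ ∏ (D ∘ lookup e′)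

  slice-reduced : ∀ (P : Poly (suc k)) → DegLt N P → ∀ e′ → Reduced (slice P e′)
  slice-reduced {k} P P<N e′ s N≤s = trans (sym (coeff-∷ʳ P e′ s)) (P<N (e′ ∷ʳ s) (fromℕ k) N≤lookup)
    where N≤lookup = ≡.subst (N ≤_) (≡.sym (lookup-∷ʳ-fromℕ e′ s)) N≤s

  ∏D-∷ʳ : ∀ (e′ : Vec ℕ k) j → ∏ (D ∘ lookup (e′ ∷ʳ j)) ∼ ∏ (D ∘ lookup e′) ⊛ D j
  ∏D-∷ʳ e′ j = ∼-trans (sum-init-last (D ∘ lookup (e′ ∷ʳ j)))
    (⊛-cong (sum-cong-≋ λ i → ∼-reflexive (cong D (lookup-∷ʳ-inject₁ e′ j i)))
            (∼-reflexive (cong D (lookup-∷ʳ-fromℕ e′ j))))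

  coeff-∷ʳ≈τ∏D : ∀ (P : Poly (suc k)) → DegLt N P → HasProductSlices P →
                 ∀ e′ j → j < N → coeff P (e′ ∷ʳ j) ≈ τ (∏ (D ∘ lookup (e′ ∷ʳ j)))
  coeff-∷ʳ≈τ∏D P P<N P-slices e′ j j<N = begin
    coeff P (e′ ∷ʳ j)                  ≈⟨ coeff-∷ʳ P e′ j ⟩
    coef (slice P e′) j                ≈⟨ τ-D⊛ (slice P e′) (slice-reduced P P<N e′) j<N ⟨
    τ (D j ⊛ slice P e′)               ≈⟨ τ-cong (⊛-congˡ (D j) (P-slices e′)) ⟩
    τ (D j ⊛ ∏ (D ∘ lookup e′))        ≈⟨ τ-cong (⊛-comm (D j) (∏ (D ∘ lookup e′))) ⟩
    τ (∏ (D ∘ lookup e′) ⊛ D j)        ≈⟨ τ-cong (∏D-∷ʳ e′ j) ⟨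
    τ (∏ (D ∘ lookup (e′ ∷ʳ j)))       ∎
    where open ≈-Reasoning

  coeff≈τ∏D : ∀ (P : Poly (suc k)) → DegLt N P → HasProductSlices P →
              ∀ e → (∀ i → lookup e i < N) → coeff P e ≈ τ (∏ (D ∘ lookup e))
  coeff≈τ∏D {k} P P<N P-slices e e<N =
    ≡.subst (λ e → coeff P e ≈ τ (∏ (D ∘ lookup e))) (≡.sym (init-∷ʳ-last e))
            (coeff-∷ʳ≈τ∏D P P<N P-slices (init e) (last e) (≡.subst (_< N) lookup-top (e<N (fromℕ k))))
    where
    lookup-top : lookup e (fromℕ k) ≡ last e
    lookup-top = ≡.trans (cong (λ v → lookup v (fromℕ k)) (init-∷ʳ-last e))
                         (lookup-∷ʳ-fromℕ (init e) (last e))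

  symmetric : ∀ (P : Poly (suc k)) → DegLt N P → HasProductSlices P → Symmetric P
  symmetric P P<N P-slices σ e = trans (coeff-permute σ P e) (by-degree (any? (λ i → N ℕ.≤? lookup e i)))
    where
    ẽ = tabulate (λ j → lookup e (σ ⟨$⟩ʳ j))
    lookup-ẽ : ∀ j → lookup ẽ j ≡ lookup e (σ ⟨$⟩ʳ j)
    lookup-ẽ = lookup∘tabulate (λ j → lookup e (σ ⟨$⟩ʳ j))
    by-degree : Dec (∃ λ i → N ≤ lookup e i) → coeff P ẽ ≈ coeff P e
    by-degree (yes (i , N≤eᵢ)) = trans (P<N ẽ (σ ⟨$⟩ˡ i) N≤ẽ) (sym (P<N e i N≤eᵢ))
      where
      N≤ẽ = ≡.subst (N ≤_) (≡.sym (≡.trans (lookup-ẽ (σ ⟨$⟩ˡ i)) (cong (lookup e) (inverseʳ σ)))) N≤eᵢ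
    by-degree (no ¬N≤e) = begin
      coeff P ẽ
        ≈⟨ coeff≈τ∏D P P<N P-slices ẽ ẽ<N ⟩
      τ (∏ (D ∘ lookup ẽ))
        ≈⟨ τ-cong (sum-cong-≋ λ i → ∼-reflexive (cong D (lookup-ẽ i))) ⟩
      τ (∏ (λ i → D (lookup e (σ ⟨$⟩ʳ i))))
        ≈⟨ τ-cong (sum-permute (D ∘ lookup e) σ) ⟨
      τ (∏ (D ∘ lookup e))
        ≈⟨ coeff≈τ∏D P P<N P-slices e e<N ⟨
      coeff P e
        ∎
      where
      open ≈-Reasoning
      e<N : ∀ i → lookup e i < N
      e<N i = ℕ.≰⇒> (¬N≤e ∘ (i ,_))
      ẽ<N : ∀ i → lookup ẽ i < N
      ẽ<N i = ≡.subst (_< N) (≡.sym (lookup-ẽ i)) (e<N (σ ⟨$⟩ʳ i))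

  oneP-terms< : ∀ {r} → All (λ t → ∀ i → lookup (proj₂ t) i < N) (oneP {r})
  oneP-terms< = (λ i → ≡.subst (_< N) (≡.sym (lookup-replicate i 0)) (s≤s z≤n)) ∷ []

  O2-terms< : ∀ {r} (i j : Fin r) → All (λ t → ∀ p → lookup (proj₂ t) p < N) (O2 N a i j)
  O2-terms< i j = concat⁺ (map⁺ {f = row} (applyUpTo⁺₁ (λ s → s) N λ {s} s<N →
    map⁺ {f = term s} (applyUpTo⁺₁ (λ l → l) (N ∸ s) λ {l} l<N∸s p →
      ≡.subst (_< N) (≡.sym (lookup-zipWith ℕ._+_ p (unit i l) (unit j s)))
        (ℕ.≤-trans (s≤s (ℕ.+-mono-≤ (lookup-unit-≤ i l p) (lookup-unit-≤ j s p)))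
                   (ℕ.m≤o∸n⇒m+n≤o (suc l) (ℕ.<⇒≤ s<N) l<N∸s)))))
    where
    term : ℕ → ℕ → Term _
    term s l = (α (s ℕ.+ l ℕ.+ 1) , zipWith ℕ._+_ (unit i l) (unit j s))
    row : ℕ → List (Term _)
    row s = map (term s) (upTo (N ∸ s))

  IsWeilOperator⇒DegLt : ∀ k (P : Poly (suc k)) → IsWeilOperator N a (suc k) P → DegLt N P
  IsWeilOperator⇒DegLt zero          P W =
    DegLt-cong P oneP (lower W) (DegLt-from-terms oneP oneP-terms<)
  IsWeilOperator⇒DegLt (suc zero)    P W =
    DegLt-cong P O2₀₁ (lower W) (DegLt-from-terms O2₀₁ (O2-terms< zero (suc zero)))
    where O2₀₁ = O2 N a zero (suc zero)
  IsWeilOperator⇒DegLt (suc (suc m)) P (P<N , _) = P<N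

  IsWeilOperator⇒slices : ∀ k (P : Poly (suc k)) → IsWeilOperator N a (suc k) P → HasProductSlices P
  IsWeilOperator⇒slices zero          P W e′ =
    ∼-trans (≐⇒∼ (slice-cong P oneP (lower W) e′)) (slice-O2-product 0 e′)
  IsWeilOperator⇒slices (suc zero)    P W e′ = ∼-trans (≐⇒∼ P≐O2₀₁*1) (slice-O2-product 1 e′)
    where
    O2₀₁ = O2 N a zero (suc zero)
    P≐O2₀₁*1 = ≐-trans (slice-cong P O2₀₁ (lower W) e′)
                       (≐-sym (slice-cong (O2₀₁ *P oneP) O2₀₁ (*P-oneP O2₀₁) e′))
  IsWeilOperator⇒slices (suc (suc m)) P (_ , H , W) e′ = begin
    slice P e′
      ≈⟨ ≐⇒∼ (≐-trans (slice-cong P (G +P F*H) W e′) (slice-+P G F*H e′)) ⟩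
    slice G e′ ⊕ slice F*H e′
      ≈⟨ ⊕-cong∼ (slice-O2-product (suc (suc m)) e′) (slice-fAt-*P∼[] H e′) ⟩
    ∏ (D ∘ lookup e′) ⊕ []
      ≡⟨ ⊕-identityʳ _ ⟩
    ∏ (D ∘ lookup e′)
      ∎
    where
    open ∼-Reasoning
    G = O2-product (suc (suc m))
    F*H = fAt N a (fromℕ (suc (suc m))) *P H

corollary2p12 : ∀ {c ℓ} (R : CommutativeRing c ℓ) → IsFiniteField R →
    (n : ℕ) → 1 ≤ n → (a : Fin n → CommutativeRing.Carrier R) →
    (r : ℕ) → 1 ≤ r → (P : WeilDefs.Poly R r) →
    WeilDefs.IsWeilOperator R n a r P → WeilDefs.Symmetric R P
corollary2p12 R _ (suc n′) _ a (suc k) _ P W =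
  symmetric P (IsWeilOperator⇒DegLt k P W) (IsWeilOperator⇒slices k P W)
  where open WeilSymmetry R n′ a
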